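{- Fix $d\ge 0$. For a vector $\mathbf k=(k_0,\dots,k_d)$ of non-negative integers with $n=|\mathbf k|$, let $a_{\mathbf k}$ be the number of essential DAGs on the labeled node set $[n]$ having exactly $k_t$ nodes of indegree $t$ for each $t=0,\dots,d$. Set $a_{\mathbf 0}=1$. Then, for $n\ge1$, $$a_{\mathbf k}=\sum_{m=1}^{n}(-1)^{m+1}\binom{n}{m}\sum_{\substack{\mathbf k=\mathbf k'+\mathbf k''\\ |\mathbf k'|=m}}\binom{m}{\mathbf k'}\prod_{t=0}^{d}\Big(\binom{n-m}{t}-k''_{t-1}\Big)^{k'_t}\,a_{\mathbf k''},$$ where the inner sum ranges over pairs of non-negative integer vectors $\mathbf k',\mathbf k''$ of length $d+1$, and $k''_{ -1}:=0$.
   Context: A DAG is a directed acyclic graph (no self-loops). It is essential (i.e., it is the unique member of its Markov equivalence class) iff every edge $a\to b$ is protected. An edge $a\to b$ is protected iff the parent set of $a$ differs from the parent set of $b$ with $a$ removed; equivalently, it is unprotected iff $\mathrm{pa}(b)=\mathrm{pa}(a)\cup\{a\}$. $|\mathbf k|$ denotes the sum of the entries of $\mathbf k$, and $\binom{m}{\mathbf k'}=\frac{m!}{\prod_t k'_t!}$ is the multinomial coefficient. -}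

module Defs where

open import Data.Bool using (Bool; true; false)
open import Data.Nat as ℕ using (ℕ; zero; suc; _+_; _*_; _∸_; _≟_; NonZero)
open import Data.Nat.Properties using (_!≢0; m*n≢0)
open import Data.Nat.Combinatorics using (_C_)
open import Data.Nat.Base using (_!; _/_)
open import Data.Integer as ℤ using (ℤ; +_; -_)
open import Data.Fin using (Fin; toℕ; inject₁)
import Data.Fin as F
open import Data.Fin.Subset using (Subset; ⁅_⁆; _─_; ∣_∣)
open import Data.Vec using (Vec; []; _∷_; lookup; tabulate; toList)
open import Data.List as L using (List; []; _∷_; length; filter; allFin; concatMap; map)
open import Data.Product using (_×_; Σ)
open import Relation.Nullary using (¬_; Dec)
open import Relation.Binary.PropositionalEquality using (_≡_)

-- Directed graphs on the labelled node set [n] = Fin n.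
-- A graph is its adjacency matrix: G ! i ! j = true  iff  i → j.

Graph : ℕ → Set
Graph n = Vec (Vec Bool n) n

Edge : ∀ {n} → Graph n → Fin n → Fin n → Set
Edge G i j = lookup (lookup G i) j ≡ true

data Path {n} (G : Graph n) : Fin n → Fin n → Set where
  step : ∀ {i j} → Edge G i j → Path G i j
  _∷ₚ_ : ∀ {i j k} → Edge G i j → Path G j k → Path G i k

Acyclic : ∀ {n} → Graph n → Set
Acyclic {n} G = (i : Fin n) → ¬ Path G i i

pa : ∀ {n} → Graph n → Fin n → Subset n
pa G b = tabulate (λ a → lookup (lookup G a) b)

Protected : ∀ {n} → Graph n → Fin n → Fin n → Set
Protected G a b = ¬ (pa G a ≡ (pa G b ─ ⁅ a ⁆))

EssentialDAG : ∀ {n} → Graph n → Set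
EssentialDAG {n} G = Acyclic G × ((a b : Fin n) → Edge G a b → Protected G a b)

indeg : ∀ {n} → Graph n → Fin n → ℕ
indeg G b = ∣ pa G b ∣

numIndeg : ∀ {n} → Graph n → ℕ → ℕ
numIndeg {n} G t = length (filter (λ v → indeg G v ≟ t) (allFin n))

∣_∣ᵥ : ∀ {m} → Vec ℕ m → ℕ
∣ [] ∣ᵥ = 0
∣ x ∷ xs ∣ᵥ = x + ∣ xs ∣ᵥ

HasProfile : ∀ {d n} → Vec ℕ (suc d) → Graph n → Set
HasProfile {d} k G = (t : Fin (suc d)) → numIndeg G (toℕ t) ≡ lookup k t

EssProfile : ∀ {d} (k : Vec ℕ (suc d)) → Graph ∣ k ∣ᵥ → Set
EssProfile k G = EssentialDAG G × HasProfile k G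

allVecs : ∀ {A : Set} (xs : List A) (m : ℕ) → List (Vec A m)
allVecs xs zero = [] ∷ []
allVecs xs (suc m) = concatMap (λ x → map (x ∷_) (allVecs xs m)) xs

allGraphs : (n : ℕ) → List (Graph n)
allGraphs n = allVecs (allVecs (true ∷ false ∷ []) n) n

aCount : ∀ {d} → (dec : (k : Vec ℕ (suc d)) (G : Graph ∣ k ∣ᵥ) → Dec (EssProfile k G))
       → Vec ℕ (suc d) → ℕ
aCount dec k = length (filter (dec k) (allGraphs ∣ k ∣ᵥ))

splits : ∀ {m} → Vec ℕ m → List (Vec ℕ m × Vec ℕ m)
splits [] = ([] Data.Product., []) ∷ []
splits (x ∷ xs) =
  concatMap (λ i → map (λ p → (toℕ i ∷ Data.Product.proj₁ p) Data.Product., ((x ∸ toℕ i) ∷ Data.Product.proj₂ p)) (splits xs))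
            (allFin (suc x))

prodFact : ∀ {m} → Vec ℕ m → ℕ
prodFact [] = 1
prodFact (x ∷ xs) = x ! * prodFact xs

prodFact≢0 : ∀ {m} (v : Vec ℕ m) → NonZero (prodFact v)
prodFact≢0 [] = _
prodFact≢0 (x ∷ xs) = m*n≢0 (x !) (prodFact xs) {{x !≢0}} {{prodFact≢0 xs}}

multinomial : ∀ {l} → ℕ → Vec ℕ l → ℕ
multinomial m k' = (m ! / prodFact k') {{prodFact≢0 k'}}

prevEntry : ∀ {d} → Vec ℕ (suc d) → Fin (suc d) → ℕ
prevEntry k'' F.zero = 0
prevEntry k'' (F.suc t) = lookup k'' (inject₁ t)

sumℤ : List ℤ → ℤ
sumℤ = L.foldr ℤ._+_ (+ 0)

prodℤ : List ℤ → ℤ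
prodℤ = L.foldr ℤ._*_ (+ 1)

signℤ : ℕ → ℤ
signℤ e = (- (+ 1)) ℤ.^ e

rhs : ∀ {d} → (dec : (k : Vec ℕ (suc d)) (G : Graph ∣ k ∣ᵥ) → Dec (EssProfile k G))
    → Vec ℕ (suc d) → ℤ
rhs {d} dec k =
  sumℤ (map (λ i → let m = suc (toℕ i) in
      signℤ (m + 1) ℤ.* (+ (n C m)) ℤ.*
      sumℤ (map (λ p → let k' = Data.Product.proj₁ p ; k'' = Data.Product.proj₂ p in
              (+ multinomial m k') ℤ.*
              prodℤ (map (λ t → ((+ ((n ∸ m) C toℕ t)) ℤ.- (+ prevEntry k'' t)) ℤ.^ lookup k' t)
                         (allFin (suc d)))
              ℤ.* (+ aCount dec k''))
            (filter (λ p → ∣ Data.Product.proj₁ p ∣ᵥ ≟ m) (splits k))))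
    (allFin n))
  where n = ∣ k ∣ᵥ

{-# OPTIONS --safe #-}

-- Every essential DAG on n ≥ 1 nodes has a sink, so inclusion–exclusion over the nonempty sets S of
-- sinks gives a_k = Σ_{S ≠ ∅} (-1)^{|S|+1} N_S, where N_S counts the essential DAGs with profile k in
-- which every node of S is a sink. Removing the m = |S| sinks leaves a DAG H on the other n - m nodes,
-- and the DAG is recovered from H and the parent sets of the sinks. It is essential iff H is and no
-- parent set Q of a sink makes an edge i → s unprotected; in an acyclic H this happens exactly when
-- Q = pa_H(i) ∪ {i}. So if H has profile k'' there are C(n-m, t) - k''_{t-1} admissible parent sets
-- of size t, and the parent sets of the sinks with indegree histogram k' can be chosen in
-- multinomial(m, k') ∏_t (C(n-m, t) - k''_{t-1})^{k'_t} ways. Summing over k = k' + k'' and grouping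
-- the sets S by size gives the recursion.

module Submission where

open import Algebra.Structures using (IsCommutativeSemiring)
open import Data.Fin.Subset using (Subset; inside; outside; ∣_∣)
open import Data.Integer as ℤ using (ℤ)
import Data.Integer.Properties as ℤₚ
open import Data.List using (List; []; _∷_)
open import Data.Nat using (ℕ; suc; _≤_)
import Data.Nat.Properties as ℕₚ
open import Data.Vec using (Vec)
open import Relation.Binary.PropositionalEquality using (_≡_; cong; module ≡-Reasoning)
open import Relation.Nullary using (Dec)
open import Defs

module SubsetSplit where

  open import Data.Fin using (Fin; zero; suc)
  open import Data.Fin.Subset using (Subset; inside; outside; ∁; ∣_∣)
  open import Data.Fin.Subset.Properties using (∣∁p∣≡n∸∣p∣; ∣p∣≤n)
  open import Data.Nat using (ℕ; zero; suc; _+_)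
  import Data.Nat.Properties as ℕₚ
  import Data.Sum as Sum
  open import Data.Sum using (_⊎_; inj₁; inj₂)
  open import Data.Sum.Properties using (inj₂-injective)
  open import Data.Vec using (_∷_; lookup)
  open import Function using (id)
  open import Relation.Binary.PropositionalEquality
  open import Relation.Nullary using (¬_)

  private variable n : ℕ

  embIn : (S : Subset n) → Fin ∣ S ∣ → Fin n
  embIn (inside  ∷ S) zero    = zero
  embIn (inside  ∷ S) (suc s) = suc (embIn S s)
  embIn (outside ∷ S) s       = suc (embIn S s)

  embOut : (S : Subset n) → Fin ∣ ∁ S ∣ → Fin n
  embOut (inside  ∷ S) i       = suc (embOut S i)
  embOut (outside ∷ S) zero    = zero
  embOut (outside ∷ S) (suc i) = suc (embOut S i)

  split : (S : Subset n) → Fin n → Fin ∣ S ∣ ⊎ Fin ∣ ∁ S ∣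
  split (inside  ∷ S) zero    = inj₁ zero
  split (inside  ∷ S) (suc x) = Sum.map suc id (split S x)
  split (outside ∷ S) zero    = inj₂ zero
  split (outside ∷ S) (suc x) = Sum.map id suc (split S x)

  split-embIn : (S : Subset n) (s : Fin ∣ S ∣) → split S (embIn S s) ≡ inj₁ s
  split-embIn (inside  ∷ S) zero    = refl
  split-embIn (inside  ∷ S) (suc s) = cong (Sum.map suc id) (split-embIn S s)
  split-embIn (outside ∷ S) s       = cong (Sum.map id suc) (split-embIn S s)

  split-embOut : (S : Subset n) (i : Fin ∣ ∁ S ∣) → split S (embOut S i) ≡ inj₂ i
  split-embOut (inside  ∷ S) i       = cong (Sum.map suc id) (split-embOut S i)
  split-embOut (outside ∷ S) zero    = refl
  split-embOut (outside ∷ S) (suc i) = cong (Sum.map id suc) (split-embOut S i)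

  data SplitView (S : Subset n) : Fin n → Set where
    isIn  : ∀ s → SplitView S (embIn S s)
    isOut : ∀ i → SplitView S (embOut S i)

  splitView : (S : Subset n) (x : Fin n) → SplitView S x
  splitView (inside  ∷ S) zero    = isIn zero
  splitView (inside  ∷ S) (suc x) with splitView S x
  ... | isIn s  = isIn (suc s)
  ... | isOut i = isOut i
  splitView (outside ∷ S) zero    = isOut zero
  splitView (outside ∷ S) (suc x) with splitView S x
  ... | isIn s  = isIn s
  ... | isOut i = isOut (suc i)

  lookup-embIn : (S : Subset n) (s : Fin ∣ S ∣) → lookup S (embIn S s) ≡ inside
  lookup-embIn (inside  ∷ S) zero    = refl
  lookup-embIn (inside  ∷ S) (suc s) = lookup-embIn S s
  lookup-embIn (outside ∷ S) s       = lookup-embIn S s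

  lookup-embOut : (S : Subset n) (i : Fin ∣ ∁ S ∣) → lookup S (embOut S i) ≡ outside
  lookup-embOut (inside  ∷ S) i       = lookup-embOut S i
  lookup-embOut (outside ∷ S) zero    = refl
  lookup-embOut (outside ∷ S) (suc i) = lookup-embOut S i

  embOut-injective : (S : Subset n) {i j : Fin ∣ ∁ S ∣} → embOut S i ≡ embOut S j → i ≡ j
  embOut-injective S {i} {j} eq =
    inj₂-injective (trans (sym (split-embOut S i)) (trans (cong (split S) eq) (split-embOut S j)))

  embIn≢embOut : (S : Subset n) (s : Fin ∣ S ∣) (i : Fin ∣ ∁ S ∣) → ¬ embIn S s ≡ embOut S i
  embIn≢embOut S s i eq with trans (sym (split-embIn S s)) (trans (cong (split S) eq) (split-embOut S i))
  ... | ()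

  ∣S∣+∣∁S∣≡n : (S : Subset n) → ∣ S ∣ + ∣ ∁ S ∣ ≡ n
  ∣S∣+∣∁S∣≡n S = trans (cong (∣ S ∣ +_) (∣∁p∣≡n∸∣p∣ S)) (ℕₚ.m+[n∸m]≡n (∣p∣≤n S))

open SubsetSplit

allSubsets : ∀ n → List (Subset n)
allSubsets n = allVecs (inside ∷ outside ∷ []) n

module FiniteSums {A : Set} {add mul : A → A → A} {0# 1# : A}
  (isCommutativeSemiring : IsCommutativeSemiring _≡_ add mul 0# 1#) where

  open import Algebra.Bundles using (CommutativeSemigroup)
  import Data.Bool as Bool
  open import Data.Bool using (Bool; true; false)
  open import Data.Empty using (⊥-elim)
  open import Data.Fin as Fin using (Fin; zero; suc; toℕ; fromℕ<)
  import Data.Fin.Properties as Finₚ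
  open import Data.Fin.Subset using (Subset; inside; outside; ∁; ∣_∣)
  open import Data.List using (List; []; _∷_; _++_; map; foldr; concatMap; filter; allFin)
  open import Data.List.Properties using (map-tabulate)
  open import Data.List.Relation.Unary.All using (All; []; _∷_)
  open import Data.Nat as ℕ using (ℕ)
  open import Data.Product using (_×_; _,_)
  import Data.Product.Properties as Productₚ
  open import Data.Vec using (Vec; []; _∷_)
  import Data.Vec.Properties as Vecₚ
  open import Function using (_∘_; id)
  open import Level using (0ℓ)
  open import Relation.Binary.Definitions using (DecidableEquality)
  open import Relation.Binary.PropositionalEquality
  open import Relation.Nullary using (Dec; yes; no; ¬_; _×-dec_)

  -- module parameters cannot carry fixities, hence these copies
  infixl 6 _+_
  infixl 7 _*_
  _+_ _*_ : A → A → A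
  _+_ = add
  _*_ = mul

  open IsCommutativeSemiring isCommutativeSemiring
    using (+-assoc; +-identityˡ; +-identityʳ; *-identityˡ; zeroˡ; zeroʳ; distribˡ; *-comm;
           +-isCommutativeSemigroup)

  private
    +-commutativeSemigroup : CommutativeSemigroup 0ℓ 0ℓ
    +-commutativeSemigroup = record { isCommutativeSemigroup = +-isCommutativeSemigroup }

  open import Algebra.Properties.CommutativeSemigroup +-commutativeSemigroup using (interchange; x∙yz≈y∙xz)

  ∑ : {B : Set} → List B → (B → A) → A
  ∑ xs f = foldr _+_ 0# (map f xs)

  infixl 10 ∑
  syntax ∑ xs (λ x → e) = ∑[ x ← xs ] e

  ∑-cong : ∀ {B : Set} (xs : List B) {f g : B → A} → (∀ x → f x ≡ g x) → ∑ xs f ≡ ∑ xs g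
  ∑-cong []       f≗g = refl
  ∑-cong (x ∷ xs) f≗g = cong₂ _+_ (f≗g x) (∑-cong xs f≗g)

  ∑-congᴬ : ∀ {B : Set} {P : B → Set} {xs : List B} {f g : B → A} →
            All P xs → (∀ x → P x → f x ≡ g x) → ∑ xs f ≡ ∑ xs g
  ∑-congᴬ []         f≗g = refl
  ∑-congᴬ (px ∷ pxs) f≗g = cong₂ _+_ (f≗g _ px) (∑-congᴬ pxs f≗g)

  ∑-zero : ∀ {B : Set} (xs : List B) {f : B → A} → (∀ x → f x ≡ 0#) → ∑ xs f ≡ 0#
  ∑-zero []       f≗0 = refl
  ∑-zero (x ∷ xs) f≗0 = trans (cong₂ _+_ (f≗0 x) (∑-zero xs f≗0)) (+-identityˡ 0#)

  ∑-++ : ∀ {B : Set} (xs ys : List B) (f : B → A) → ∑ (xs ++ ys) f ≡ ∑ xs f + ∑ ys f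
  ∑-++ []       ys f = sym (+-identityˡ _)
  ∑-++ (x ∷ xs) ys f = trans (cong (f x +_) (∑-++ xs ys f)) (sym (+-assoc _ _ _))

  ∑-map : ∀ {B C : Set} (xs : List B) (g : B → C) (f : C → A) → ∑ (map g xs) f ≡ ∑ xs (f ∘ g)
  ∑-map []       g f = refl
  ∑-map (x ∷ xs) g f = cong (f (g x) +_) (∑-map xs g f)

  ∑-concatMap : ∀ {B C : Set} (xs : List B) (g : B → List C) (f : C → A) →
                ∑ (concatMap g xs) f ≡ ∑[ x ← xs ] ∑ (g x) f
  ∑-concatMap []       g f = refl
  ∑-concatMap (x ∷ xs) g f =
    trans (∑-++ (g x) (concatMap g xs) f) (cong (∑ (g x) f +_) (∑-concatMap xs g f))

  ∑-distrib-+ : ∀ {B : Set} (xs : List B) (f g : B → A) →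
                ∑[ x ← xs ] (f x + g x) ≡ ∑ xs f + ∑ xs g
  ∑-distrib-+ []       f g = sym (+-identityˡ 0#)
  ∑-distrib-+ (x ∷ xs) f g =
    trans (cong ((f x + g x) +_) (∑-distrib-+ xs f g)) (interchange _ _ _ _)

  *-distribˡ-∑ : ∀ {B : Set} (xs : List B) (c : A) (f : B → A) → c * ∑ xs f ≡ ∑[ x ← xs ] (c * f x)
  *-distribˡ-∑ []       c f = zeroʳ c
  *-distribˡ-∑ (x ∷ xs) c f = trans (distribˡ c _ _) (cong ((c * f x) +_) (*-distribˡ-∑ xs c f))

  *-distribʳ-∑ : ∀ {B : Set} (xs : List B) (c : A) (f : B → A) → ∑ xs f * c ≡ ∑[ x ← xs ] (f x * c)
  *-distribʳ-∑ xs c f =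
    trans (*-comm _ c) (trans (*-distribˡ-∑ xs c f) (∑-cong xs (λ x → *-comm c (f x))))

  ∑-comm : ∀ {B C : Set} (xs : List B) (ys : List C) (f : B → C → A) →
           ∑[ x ← xs ] ∑[ y ← ys ] f x y ≡ ∑[ y ← ys ] ∑[ x ← xs ] f x y
  ∑-comm []       ys f = sym (∑-zero ys (λ _ → refl))
  ∑-comm (x ∷ xs) ys f =
    trans (cong (∑ ys (f x) +_) (∑-comm xs ys f)) (sym (∑-distrib-+ ys (f x) _))

  ∑-allFin-suc : ∀ n (f : Fin (ℕ.suc n) → A) → ∑ (allFin (ℕ.suc n)) f ≡ f zero + ∑ (allFin n) (f ∘ suc)
  ∑-allFin-suc n f =
    cong (λ xs → f zero + foldr _+_ 0# xs) (trans (map-tabulate suc f) (sym (map-tabulate id (f ∘ suc))))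

  ∏ : {B : Set} → List B → (B → A) → A
  ∏ xs f = foldr _*_ 1# (map f xs)

  infixl 10 ∏
  syntax ∏ xs (λ x → e) = ∏[ x ← xs ] e

  ∏-cong : ∀ {B : Set} (xs : List B) {f g : B → A} → (∀ x → f x ≡ g x) → ∏ xs f ≡ ∏ xs g
  ∏-cong []       f≗g = refl
  ∏-cong (x ∷ xs) f≗g = cong₂ _*_ (f≗g x) (∏-cong xs f≗g)

  ∏-const-1# : ∀ {B : Set} (xs : List B) → ∏ xs (λ _ → 1#) ≡ 1#
  ∏-const-1# []       = refl
  ∏-const-1# (x ∷ xs) = trans (cong (1# *_) (∏-const-1# xs)) (*-identityˡ 1#)

  ∏-allFin-suc : ∀ n (f : Fin (ℕ.suc n) → A) → ∏ (allFin (ℕ.suc n)) f ≡ f zero * ∏ (allFin n) (f ∘ suc)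
  ∏-allFin-suc n f =
    cong (λ xs → f zero * foldr _*_ 1# xs) (trans (map-tabulate suc f) (sym (map-tabulate id (f ∘ suc))))

  ∑-allFin-split : ∀ {n} (S : Subset n) (f : Fin n → A) →
    ∑ (allFin n) f ≡ ∑ (allFin ∣ S ∣) (f ∘ embIn S) + ∑ (allFin ∣ ∁ S ∣) (f ∘ embOut S)
  ∑-allFin-split []            f = sym (+-identityˡ 0#)
  ∑-allFin-split (inside ∷ S)  f = begin
    ∑ (allFin _) f
      ≡⟨ ∑-allFin-suc _ f ⟩
    f zero + ∑ (allFin _) (f ∘ suc)
      ≡⟨ cong (f zero +_) (∑-allFin-split S (f ∘ suc)) ⟩
    f zero + (∑ (allFin ∣ S ∣) (f ∘ suc ∘ embIn S) + rest)
      ≡⟨ +-assoc (f zero) _ rest ⟨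
    f zero + ∑ (allFin ∣ S ∣) (f ∘ suc ∘ embIn S) + rest
      ≡⟨ cong (_+ rest) (∑-allFin-suc _ (f ∘ embIn (inside ∷ S))) ⟨
    ∑ (allFin _) (f ∘ embIn (inside ∷ S)) + rest ∎
    where
    open ≡-Reasoning
    rest : A
    rest = ∑ (allFin ∣ ∁ S ∣) (f ∘ suc ∘ embOut S)
  ∑-allFin-split (outside ∷ S) f = begin
    ∑ (allFin _) f
      ≡⟨ ∑-allFin-suc _ f ⟩
    f zero + ∑ (allFin _) (f ∘ suc)
      ≡⟨ cong (f zero +_) (∑-allFin-split S (f ∘ suc)) ⟩
    f zero + (rest + ∑ (allFin ∣ ∁ S ∣) (f ∘ suc ∘ embOut S))
      ≡⟨ x∙yz≈y∙xz (f zero) rest _ ⟩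
    rest + (f zero + ∑ (allFin ∣ ∁ S ∣) (f ∘ suc ∘ embOut S))
      ≡⟨ cong (rest +_) (∑-allFin-suc _ (f ∘ embOut (outside ∷ S))) ⟨
    rest + ∑ (allFin _) (f ∘ embOut (outside ∷ S)) ∎
    where
    open ≡-Reasoning
    rest : A
    rest = ∑ (allFin ∣ S ∣) (f ∘ suc ∘ embIn S)

  𝟙 : ∀ {P : Set} → Dec P → A
  𝟙 (yes _) = 1#
  𝟙 (no _)  = 0#

  𝟙-yes : ∀ {P : Set} (P? : Dec P) → P → 𝟙 P? ≡ 1#
  𝟙-yes (yes _) p = refl
  𝟙-yes (no ¬p) p = ⊥-elim (¬p p)

  𝟙-no : ∀ {P : Set} (P? : Dec P) → ¬ P → 𝟙 P? ≡ 0#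
  𝟙-no (yes p) ¬p = ⊥-elim (¬p p)
  𝟙-no (no _)  ¬p = refl

  𝟙-⇔ : ∀ {P Q : Set} (P? : Dec P) (Q? : Dec Q) → (P → Q) → (Q → P) → 𝟙 P? ≡ 𝟙 Q?
  𝟙-⇔ (yes p) Q? to from = sym (𝟙-yes Q? (to p))
  𝟙-⇔ (no ¬p) Q? to from = sym (𝟙-no Q? (¬p ∘ from))

  𝟙-× : ∀ {P Q : Set} (P? : Dec P) (Q? : Dec Q) → 𝟙 (P? ×-dec Q?) ≡ 𝟙 P? * 𝟙 Q?
  𝟙-× (yes p) (yes q) = sym (*-identityˡ 1#)
  𝟙-× (yes p) (no ¬q) = sym (*-identityˡ 0#)
  𝟙-× (no ¬p) Q?      = sym (zeroˡ _)

  𝟙-*-cong : ∀ {P : Set} (P? : Dec P) {x y : A} → (P → x ≡ y) → 𝟙 P? * x ≡ 𝟙 P? * y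
  𝟙-*-cong (yes p) x≡y = cong (1# *_) (x≡y p)
  𝟙-*-cong (no _)  x≡y = trans (zeroˡ _) (sym (zeroˡ _))

  ∑-filter : ∀ {B : Set} {P : B → Set} (P? : ∀ x → Dec (P x)) (xs : List B) (f : B → A) →
             ∑ (filter P? xs) f ≡ ∑[ x ← xs ] (𝟙 (P? x) * f x)
  ∑-filter P? []       f = refl
  ∑-filter P? (x ∷ xs) f with P? x
  ... | yes _ = cong₂ _+_ (sym (*-identityˡ (f x))) (∑-filter P? xs f)
  ... | no _  = trans (∑-filter P? xs f)
    (sym (trans (cong (_+ ∑[ y ← xs ] (𝟙 (P? y) * f y)) (zeroˡ (f x))) (+-identityˡ _)))

  module _ {B : Set} (_≟_ : DecidableEquality B) where

    record IsEnumeration (xs : List B) : Set where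
      constructor occursOnce
      field occurs-once : ∀ x → ∑[ y ← xs ] 𝟙 (x ≟ y) ≡ 1#

    open IsEnumeration public

    ∑-select : ∀ {xs} → IsEnumeration xs → ∀ x (f : B → A) → ∑[ y ← xs ] (𝟙 (x ≟ y) * f y) ≡ f x
    ∑-select {xs} enum x f = begin
      ∑[ y ← xs ] (𝟙 (x ≟ y) * f y)
        ≡⟨ ∑-cong xs (λ y → 𝟙-*-cong (x ≟ y) (λ x≡y → cong f (sym x≡y))) ⟩
      ∑[ y ← xs ] (𝟙 (x ≟ y) * f x)
        ≡⟨ *-distribʳ-∑ xs (f x) _ ⟨
      (∑[ y ← xs ] 𝟙 (x ≟ y)) * f x
        ≡⟨ cong (_* f x) (occurs-once enum x) ⟩
      1# * f x
        ≡⟨ *-identityˡ (f x) ⟩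
      f x ∎
      where open ≡-Reasoning

  ∑-bijection : ∀ {B C : Set} {_≟B_ : DecidableEquality B} {_≟C_ : DecidableEquality C}
    {xs : List B} {ys : List C} → IsEnumeration _≟B_ xs → IsEnumeration _≟C_ ys →
    {Q : B → Set} (Q? : ∀ b → Dec (Q b)) (φ : C → B) (ψ : B → C) →
    (∀ c → Q (φ c)) → (∀ c → ψ (φ c) ≡ c) → (∀ b → Q b → φ (ψ b) ≡ b) →
    (f : B → A) → ∑[ b ← xs ] (𝟙 (Q? b) * f b) ≡ ∑[ c ← ys ] f (φ c)
  ∑-bijection {_≟B_ = _≟B_} {_≟C_} {xs} {ys} enumB enumC {Q} Q? φ ψ Qφ ψφ φψ f = sym (begin
    ∑[ c ← ys ] f (φ c)
      ≡⟨ ∑-cong ys (λ c → sym (∑-select _≟B_ enumB (φ c) f)) ⟩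
    ∑[ c ← ys ] ∑[ b ← xs ] (𝟙 (φ c ≟B b) * f b)
      ≡⟨ ∑-comm ys xs (λ c b → 𝟙 (φ c ≟B b) * f b) ⟩
    ∑[ b ← xs ] ∑[ c ← ys ] (𝟙 (φ c ≟B b) * f b)
      ≡⟨ ∑-cong xs (λ b → sym (*-distribʳ-∑ ys (f b) _)) ⟩
    ∑[ b ← xs ] (∑[ c ← ys ] 𝟙 (φ c ≟B b) * f b)
      ≡⟨ ∑-cong xs (λ b → cong (_* f b) (preimages b (Q? b))) ⟩
    ∑[ b ← xs ] (𝟙 (Q? b) * f b) ∎)
    where
    open ≡-Reasoning
    preimages : ∀ b (Q?b : Dec (Q b)) → ∑[ c ← ys ] 𝟙 (φ c ≟B b) ≡ 𝟙 Q?b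
    preimages b (yes q) = trans
      (∑-cong ys (λ c → 𝟙-⇔ (φ c ≟B b) (ψ b ≟C c)
        (λ φc≡b → trans (cong ψ (sym φc≡b)) (ψφ c)) (λ ψb≡c → trans (cong φ (sym ψb≡c)) (φψ b q))))
      (occurs-once enumC (ψ b))
    preimages b (no ¬q) = ∑-zero ys (λ c → 𝟙-no (φ c ≟B b) (λ φc≡b → ¬q (subst Q φc≡b (Qφ c))))

  allFin-isEnumeration : ∀ n → IsEnumeration Fin._≟_ (allFin n)
  allFin-isEnumeration n = occursOnce (once n)
    where
    open ≡-Reasoning
    once : ∀ n (x : Fin n) → ∑[ y ← allFin n ] 𝟙 (x Fin.≟ y) ≡ 1#
    once (ℕ.suc n) zero = begin
      ∑ (allFin (ℕ.suc n)) (λ y → 𝟙 (zero Fin.≟ y)) ≡⟨ ∑-allFin-suc n _ ⟩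
      1# + ∑ (allFin n) (λ y → 𝟙 (zero Fin.≟ suc y)) ≡⟨ cong (1# +_) (∑-zero (allFin n) (λ y → refl)) ⟩
      1# + 0#                                        ≡⟨ +-identityʳ 1# ⟩
      1#                                             ∎
    once (ℕ.suc n) (suc x) = begin
      ∑ (allFin (ℕ.suc n)) (λ y → 𝟙 (suc x Fin.≟ y))
        ≡⟨ ∑-allFin-suc n _ ⟩
      0# + ∑ (allFin n) (λ y → 𝟙 (suc x Fin.≟ suc y))
        ≡⟨ +-identityˡ _ ⟩
      ∑ (allFin n) (λ y → 𝟙 (suc x Fin.≟ suc y))
        ≡⟨ ∑-cong (allFin n) (λ y → 𝟙-⇔ (suc x Fin.≟ suc y) (x Fin.≟ y) Finₚ.suc-injective (cong suc)) ⟩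
      ∑ (allFin n) (λ y → 𝟙 (x Fin.≟ y))
        ≡⟨ once n x ⟩
      1# ∎

  ∑-select-toℕ : ∀ {D} x (x<D : x ℕ.< D) (g : Fin D → A) →
                 ∑[ u ← allFin D ] (𝟙 (x ℕ.≟ toℕ u) * g u) ≡ g (fromℕ< x<D)
  ∑-select-toℕ {D} x x<D g = trans
    (∑-cong (allFin D) (λ u → cong (_* g u) (𝟙-⇔ (x ℕ.≟ toℕ u) (fromℕ< x<D Fin.≟ u)
      (λ x≡u → Finₚ.toℕ-injective (trans (Finₚ.toℕ-fromℕ< x<D) x≡u))
      (λ { refl → sym (Finₚ.toℕ-fromℕ< x<D) }))))
    (∑-select Fin._≟_ (allFin-isEnumeration D) (fromℕ< x<D) g)

  ∑-select-toℕ-≥ : ∀ {D} x → ¬ x ℕ.< D → (g : Fin D → A) →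
                   ∑[ u ← allFin D ] (𝟙 (x ℕ.≟ toℕ u) * g u) ≡ 0#
  ∑-select-toℕ-≥ {D} x x≮D g = ∑-zero (allFin D) (λ u →
    trans (cong (_* g u) (𝟙-no (x ℕ.≟ toℕ u) (λ { refl → x≮D (Finₚ.toℕ<n u) }))) (zeroˡ (g u)))

  bools-isEnumeration : IsEnumeration Bool._≟_ (true ∷ false ∷ [])
  bools-isEnumeration = occursOnce λ
    { true  → trans (cong (1# +_) (+-identityʳ 0#)) (+-identityʳ 1#)
    ; false → trans (+-identityˡ _) (+-identityʳ 1#) }

  ∑-allVecs-suc : ∀ {B : Set} (xs : List B) m (f : Vec B (ℕ.suc m) → A) →
                  ∑ (allVecs xs (ℕ.suc m)) f ≡ ∑[ x ← xs ] ∑[ v ← allVecs xs m ] f (x ∷ v)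
  ∑-allVecs-suc xs m f = trans (∑-concatMap xs _ f) (∑-cong xs (λ x → ∑-map (allVecs xs m) (x ∷_) f))

  allVecs-isEnumeration : ∀ {B : Set} {_≟_ : DecidableEquality B} {xs : List B} →
    IsEnumeration _≟_ xs → ∀ m → IsEnumeration (Vecₚ.≡-dec _≟_) (allVecs xs m)
  allVecs-isEnumeration enum 0 = occursOnce λ { [] → +-identityʳ 1# }
  allVecs-isEnumeration {B} {_≟_} {xs} enum (ℕ.suc m) = occursOnce λ { (x ∷ v) → once x v }
    where
    _≟ᵥ_ : ∀ {k} → DecidableEquality (Vec B k)
    _≟ᵥ_ = Vecₚ.≡-dec _≟_
    open ≡-Reasoning
    once : ∀ x v → ∑[ w ← allVecs xs (ℕ.suc m) ] 𝟙 ((x ∷ v) ≟ᵥ w) ≡ 1#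
    once x v = begin
      ∑[ w ← allVecs xs (ℕ.suc m) ] 𝟙 ((x ∷ v) ≟ᵥ w)
        ≡⟨ ∑-allVecs-suc xs m _ ⟩
      ∑[ y ← xs ] ∑[ w ← allVecs xs m ] 𝟙 ((x ∷ v) ≟ᵥ (y ∷ w))
        ≡⟨ ∑-cong xs (λ y → ∑-cong (allVecs xs m) (λ w → trans
             (𝟙-⇔ ((x ∷ v) ≟ᵥ (y ∷ w)) ((x ≟ y) ×-dec (v ≟ᵥ w))
                  Vecₚ.∷-injective (λ { (refl , refl) → refl }))
             (𝟙-× (x ≟ y) (v ≟ᵥ w)))) ⟩
      ∑[ y ← xs ] ∑[ w ← allVecs xs m ] (𝟙 (x ≟ y) * 𝟙 (v ≟ᵥ w))
        ≡⟨ ∑-cong xs (λ y → sym (*-distribˡ-∑ (allVecs xs m) (𝟙 (x ≟ y)) _)) ⟩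
      ∑[ y ← xs ] (𝟙 (x ≟ y) * (∑[ w ← allVecs xs m ] 𝟙 (v ≟ᵥ w)))
        ≡⟨ ∑-select _≟_ enum x (λ _ → ∑[ w ← allVecs xs m ] 𝟙 (v ≟ᵥ w)) ⟩
      ∑[ w ← allVecs xs m ] 𝟙 (v ≟ᵥ w)
        ≡⟨ occurs-once (allVecs-isEnumeration enum m) v ⟩
      1# ∎

  ∑-allSubsets-suc : ∀ n (f : Subset (ℕ.suc n) → A) →
    ∑ (allSubsets (ℕ.suc n)) f ≡ ∑[ Q ← allSubsets n ] f (inside ∷ Q) + ∑[ Q ← allSubsets n ] f (outside ∷ Q)
  ∑-allSubsets-suc n f =
    trans (∑-allVecs-suc _ n f) (cong (∑[ Q ← allSubsets n ] f (inside ∷ Q) +_) (+-identityʳ _))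

  pairs : ∀ {B C : Set} → List B → List C → List (B × C)
  pairs xs ys = concatMap (λ x → map (x ,_) ys) xs

  ∑-pairs : ∀ {B C : Set} (xs : List B) (ys : List C) (f : B × C → A) →
            ∑ (pairs xs ys) f ≡ ∑[ x ← xs ] ∑[ y ← ys ] f (x , y)
  ∑-pairs xs ys f = trans (∑-concatMap xs _ f) (∑-cong xs (λ x → ∑-map ys (x ,_) f))

  pairs-isEnumeration : ∀ {B C : Set} {_≟B_ : DecidableEquality B} {_≟C_ : DecidableEquality C}
    {xs : List B} {ys : List C} → IsEnumeration _≟B_ xs → IsEnumeration _≟C_ ys →
    IsEnumeration (Productₚ.≡-dec _≟B_ _≟C_) (pairs xs ys)
  pairs-isEnumeration {_≟B_ = _≟B_} {_≟C_} {xs} {ys} enumB enumC = occursOnce λ { (x , y) → once x y }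
    where
    _≟ₚ_ : DecidableEquality (_ × _)
    _≟ₚ_ = Productₚ.≡-dec _≟B_ _≟C_
    open ≡-Reasoning
    once : ∀ x y → ∑[ p ← pairs xs ys ] 𝟙 ((x , y) ≟ₚ p) ≡ 1#
    once x y = begin
      ∑[ p ← pairs xs ys ] 𝟙 ((x , y) ≟ₚ p)
        ≡⟨ ∑-pairs xs ys _ ⟩
      ∑[ a ← xs ] ∑[ b ← ys ] 𝟙 ((x , y) ≟ₚ (a , b))
        ≡⟨ ∑-cong xs (λ a → ∑-cong ys (λ b → trans
             (𝟙-⇔ ((x , y) ≟ₚ (a , b)) ((x ≟B a) ×-dec (y ≟C b))
                  Productₚ.,-injective (λ { (refl , refl) → refl }))
             (𝟙-× (x ≟B a) (y ≟C b)))) ⟩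
      ∑[ a ← xs ] ∑[ b ← ys ] (𝟙 (x ≟B a) * 𝟙 (y ≟C b))
        ≡⟨ ∑-cong xs (λ a → sym (*-distribˡ-∑ ys (𝟙 (x ≟B a)) _)) ⟩
      ∑[ a ← xs ] (𝟙 (x ≟B a) * (∑[ b ← ys ] 𝟙 (y ≟C b)))
        ≡⟨ ∑-select _≟B_ enumB x (λ _ → ∑[ b ← ys ] 𝟙 (y ≟C b)) ⟩
      ∑[ b ← ys ] 𝟙 (y ≟C b)
        ≡⟨ occurs-once enumC y ⟩
      1# ∎

module ℕΣ = FiniteSums ℕₚ.+-*-isCommutativeSemiring
module ℤΣ = FiniteSums ℤₚ.+-*-isCommutativeSemiring

module Graphs where

  open import Data.Bool using (Bool; false)
  open import Data.Bool.Properties using (¬-not)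
  open import Data.Empty using (⊥-elim)
  open import Data.Fin using (Fin; zero; suc; _≟_)
  open import Data.Fin.Subset using (Subset; inside; outside; ⁅_⁆; _─_; ∁; ∣_∣)
  open import Data.Fin.Subset.Properties using (x∈⁅x⁆; x≢y⇒x∉⁅y⁆)
  open import Data.Nat using (ℕ)
  open import Data.Product using (_×_; _,_; ∃; proj₂)
  open import Data.Sum using (_⊎_; inj₁; inj₂)
  open import Data.Vec using (Vec; _∷_; lookup; tabulate)
  open import Data.Vec.Properties using (lookup∘tabulate; []=⇒lookup; lookup⇒[]=)
  open import Data.Vec.Relation.Binary.Pointwise.Extensional using (ext; Pointwise-≡⇒≡)
  open import Relation.Binary.PropositionalEquality
  open import Relation.Nullary using (¬_; yes; no)

  private variable n : ℕ

  edge : Graph n → Fin n → Fin n → Bool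
  edge G i j = lookup (lookup G i) j

  lookup-ext : ∀ {A : Set} {u v : Vec A n} → (∀ i → lookup u i ≡ lookup v i) → u ≡ v
  lookup-ext u≗v = Pointwise-≡⇒≡ (ext u≗v)

  lookup-pa : (G : Graph n) (b a : Fin n) → lookup (pa G b) a ≡ edge G a b
  lookup-pa G b a = lookup∘tabulate (λ a → edge G a b) a

  lookup-⁅x⁆ : (x : Fin n) → lookup ⁅ x ⁆ x ≡ inside
  lookup-⁅x⁆ x = []=⇒lookup (x∈⁅x⁆ x)

  lookup-⁅y⁆ : {x y : Fin n} → x ≢ y → lookup ⁅ y ⁆ x ≡ outside
  lookup-⁅y⁆ x≢y = ¬-not (λ x∈⁅y⁆ → x≢y⇒x∉⁅y⁆ x≢y (lookup⇒[]= _ _ x∈⁅y⁆))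

  lookup-─-inside : (p q : Subset n) (x : Fin n) → lookup q x ≡ inside → lookup (p ─ q) x ≡ outside
  lookup-─-inside (_ ∷ p) (inside ∷ q) zero    _  = refl
  lookup-─-inside (_ ∷ p) (_      ∷ q) (suc x) eq = lookup-─-inside p q x eq

  lookup-─-outside : (p q : Subset n) (x : Fin n) → lookup q x ≡ outside → lookup (p ─ q) x ≡ lookup p x
  lookup-─-outside (_ ∷ p) (outside ∷ q) zero    _  = refl
  lookup-─-outside (_ ∷ p) (_       ∷ q) (suc x) eq = lookup-─-outside p q x eq

  lookup-─⁅x⁆ : (p : Subset n) (x : Fin n) → lookup (p ─ ⁅ x ⁆) x ≡ outside
  lookup-─⁅x⁆ p x = lookup-─-inside p ⁅ x ⁆ x (lookup-⁅x⁆ x)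

  lookup-─⁅y⁆ : (p : Subset n) {x y : Fin n} → x ≢ y → lookup (p ─ ⁅ y ⁆) x ≡ lookup p x
  lookup-─⁅y⁆ p x≢y = lookup-─-outside p _ _ (lookup-⁅y⁆ x≢y)

  firstEdge : {G : Graph n} {x y : Fin n} → Path G x y → ∃ (Edge G x)
  firstEdge (step e)  = _ , e
  firstEdge (e ∷ₚ _) = _ , e

  -- Q, as the parent set of a new sink s, makes the edge i → s unprotected.
  Unprotecting : Graph n → Subset n → Fin n → Set
  Unprotecting H Q i = lookup Q i ≡ inside × pa H i ≡ Q ─ ⁅ i ⁆

  Admissible : Graph n → Subset n → Set
  Admissible H Q = ∀ i → ¬ Unprotecting H Q i

  -- Given S ⊆ [n], a graph on [n] in which every member of S is a sink is the same as a graph H on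
  -- the complement of S together with a parent set P s ⊆ ∁ S for every s ∈ S.
  module Adjoin (S : Subset n) where

    private
      m n′ : ℕ
      m  = ∣ S ∣
      n′ = ∣ ∁ S ∣

    adjoinedEdge : Graph n′ → Vec (Subset n′) m → Fin m ⊎ Fin n′ → Fin m ⊎ Fin n′ → Bool
    adjoinedEdge H P (inj₁ _) _        = false
    adjoinedEdge H P (inj₂ i) (inj₁ s) = lookup (lookup P s) i
    adjoinedEdge H P (inj₂ i) (inj₂ j) = edge H i j

    adjoin : Graph n′ → Vec (Subset n′) m → Graph n
    adjoin H P = tabulate λ x → tabulate λ y → adjoinedEdge H P (split S x) (split S y)

    core : Graph n → Graph n′
    core G = tabulate λ i → tabulate λ j → edge G (embOut S i) (embOut S j)

    sinkParents : Graph n → Vec (Subset n′) m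
    sinkParents G = tabulate λ s → tabulate λ i → edge G (embOut S i) (embIn S s)

    SinksAt : Graph n → Set
    SinksAt G = ∀ s y → edge G (embIn S s) y ≡ false

    module _ (H : Graph n′) (P : Vec (Subset n′) m) where

      edge-adjoin : ∀ x y → edge (adjoin H P) x y ≡ adjoinedEdge H P (split S x) (split S y)
      edge-adjoin x y = trans (cong (λ r → lookup r y) (lookup∘tabulate _ x)) (lookup∘tabulate _ y)

      edge-adjoin-out-out : ∀ i j → edge (adjoin H P) (embOut S i) (embOut S j) ≡ edge H i j
      edge-adjoin-out-out i j =
        trans (edge-adjoin _ _) (cong₂ (adjoinedEdge H P) (split-embOut S i) (split-embOut S j))

      edge-adjoin-out-in : ∀ i s → edge (adjoin H P) (embOut S i) (embIn S s) ≡ lookup (lookup P s) i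
      edge-adjoin-out-in i s =
        trans (edge-adjoin _ _) (cong₂ (adjoinedEdge H P) (split-embOut S i) (split-embIn S s))

      adjoin-sinksAt : SinksAt (adjoin H P)
      adjoin-sinksAt s y =
        trans (edge-adjoin _ _) (cong (λ z → adjoinedEdge H P z (split S y)) (split-embIn S s))

      core-adjoin : core (adjoin H P) ≡ H
      core-adjoin = lookup-ext λ i → trans (lookup∘tabulate _ i) (lookup-ext λ j →
        trans (lookup∘tabulate _ j) (edge-adjoin-out-out i j))

      sinkParents-adjoin : sinkParents (adjoin H P) ≡ P
      sinkParents-adjoin = lookup-ext λ s → trans (lookup∘tabulate _ s) (lookup-ext λ i →
        trans (lookup∘tabulate _ i) (edge-adjoin-out-in i s))

      ¬Edge-fromIn : ∀ {s y} → ¬ Edge (adjoin H P) (embIn S s) y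
      ¬Edge-fromIn {s} {y} e with trans (sym e) (adjoin-sinksAt s y)
      ... | ()

      path-adjoin⇒path : ∀ {i j} → Path (adjoin H P) (embOut S i) (embOut S j) → Path H i j
      path-adjoin⇒path (step e) = step (trans (sym (edge-adjoin-out-out _ _)) e)
      path-adjoin⇒path (_∷ₚ_ {j = z} e p) with splitView S z
      ... | isIn s  = ⊥-elim (¬Edge-fromIn (proj₂ (firstEdge p)))
      ... | isOut l = trans (sym (edge-adjoin-out-out _ _)) e ∷ₚ path-adjoin⇒path p

      path⇒path-adjoin : ∀ {i j} → Path H i j → Path (adjoin H P) (embOut S i) (embOut S j)
      path⇒path-adjoin (step e) = step (trans (edge-adjoin-out-out _ _) e)
      path⇒path-adjoin (e ∷ₚ p) = trans (edge-adjoin-out-out _ _) e ∷ₚ path⇒path-adjoin p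

      acyclic-adjoin⁺ : Acyclic H → Acyclic (adjoin H P)
      acyclic-adjoin⁺ acyclic x cycle with splitView S x
      ... | isIn s  = ¬Edge-fromIn (proj₂ (firstEdge cycle))
      ... | isOut i = acyclic i (path-adjoin⇒path cycle)

      acyclic-adjoin⁻ : Acyclic (adjoin H P) → Acyclic H
      acyclic-adjoin⁻ acyclic i cycle = acyclic (embOut S i) (path⇒path-adjoin cycle)

    adjoin-core : ∀ G → SinksAt G → adjoin (core G) (sinkParents G) ≡ G
    adjoin-core G sinksAt = lookup-ext λ x → lookup-ext λ y →
      trans (edge-adjoin (core G) (sinkParents G) x y) (agree (splitView S x) (splitView S y))
      where
      agree : ∀ {x y} → SplitView S x → SplitView S y →
              adjoinedEdge (core G) (sinkParents G) (split S x) (split S y) ≡ edge G x y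
      agree {y = y} (isIn s) _ =
        trans (cong (λ z → adjoinedEdge (core G) (sinkParents G) z (split S y)) (split-embIn S s)) (sym (sinksAt s y))
      agree (isOut i) (isIn s) =
        trans (cong₂ (adjoinedEdge (core G) (sinkParents G)) (split-embOut S i) (split-embIn S s))
              (trans (cong (λ r → lookup r i) (lookup∘tabulate _ s)) (lookup∘tabulate _ i))
      agree (isOut i) (isOut j) =
        trans (cong₂ (adjoinedEdge (core G) (sinkParents G)) (split-embOut S i) (split-embOut S j))
              (trans (cong (λ r → lookup r j) (lookup∘tabulate _ i)) (lookup∘tabulate _ j))

    liftedSide : Subset n′ → Fin m ⊎ Fin n′ → Bool
    liftedSide v (inj₁ _) = outside
    liftedSide v (inj₂ i) = lookup v i

    lift : Subset n′ → Subset n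
    lift v = tabulate λ x → liftedSide v (split S x)

    lookup-lift-in : ∀ v s → lookup (lift v) (embIn S s) ≡ outside
    lookup-lift-in v s = trans (lookup∘tabulate _ (embIn S s)) (cong (liftedSide v) (split-embIn S s))

    lookup-lift-out : ∀ v i → lookup (lift v) (embOut S i) ≡ lookup v i
    lookup-lift-out v i = trans (lookup∘tabulate _ (embOut S i)) (cong (liftedSide v) (split-embOut S i))

    lift-injective : ∀ {u v} → lift u ≡ lift v → u ≡ v
    lift-injective {u} {v} eq = lookup-ext λ i →
      trans (sym (lookup-lift-out u i)) (trans (cong (λ w → lookup w (embOut S i)) eq) (lookup-lift-out v i))

    lift-─⁅⁆ : ∀ u i → lift (u ─ ⁅ i ⁆) ≡ lift u ─ ⁅ embOut S i ⁆
    lift-─⁅⁆ u i = lookup-ext λ x → agree (splitView S x)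
      where
      agree : ∀ {x} → SplitView S x → lookup (lift (u ─ ⁅ i ⁆)) x ≡ lookup (lift u ─ ⁅ embOut S i ⁆) x
      agree (isIn s) = trans (lookup-lift-in _ s)
        (sym (trans (lookup-─⁅y⁆ (lift u) (embIn≢embOut S s i)) (lookup-lift-in u s)))
      agree (isOut j) with j ≟ i
      ... | yes refl = trans (lookup-lift-out _ i)
        (trans (lookup-─⁅x⁆ u i) (sym (lookup-─⁅x⁆ (lift u) (embOut S i))))
      ... | no j≢i = trans (lookup-lift-out _ j) (trans (lookup-─⁅y⁆ u j≢i)
        (sym (trans (lookup-─⁅y⁆ (lift u) (λ eq → j≢i (embOut-injective S eq))) (lookup-lift-out u j))))

    module _ (H : Graph n′) (P : Vec (Subset n′) m) where

      pa-adjoin-out : ∀ j → pa (adjoin H P) (embOut S j) ≡ lift (pa H j)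
      pa-adjoin-out j = lookup-ext λ x → trans (lookup-pa (adjoin H P) _ x) (agree (splitView S x))
        where
        agree : ∀ {x} → SplitView S x → edge (adjoin H P) x (embOut S j) ≡ lookup (lift (pa H j)) x
        agree (isIn s)  = trans (adjoin-sinksAt H P s _) (sym (lookup-lift-in _ s))
        agree (isOut i) = trans (edge-adjoin-out-out H P i j)
          (sym (trans (lookup-lift-out _ i) (lookup-pa H j i)))

      pa-adjoin-in : ∀ s → pa (adjoin H P) (embIn S s) ≡ lift (lookup P s)
      pa-adjoin-in s = lookup-ext λ x → trans (lookup-pa (adjoin H P) _ x) (agree (splitView S x))
        where
        agree : ∀ {x} → SplitView S x → edge (adjoin H P) x (embIn S s) ≡ lookup (lift (lookup P s)) x
        agree (isIn t)  = trans (adjoin-sinksAt H P t _) (sym (lookup-lift-in _ t))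
        agree (isOut i) = trans (edge-adjoin-out-in H P i s) (sym (lookup-lift-out _ i))

      unprotected-adjoin⁻ : ∀ i Q →
        pa (adjoin H P) (embOut S i) ≡ lift Q ─ ⁅ embOut S i ⁆ → pa H i ≡ Q ─ ⁅ i ⁆
      unprotected-adjoin⁻ i Q eq = lift-injective (trans (sym (pa-adjoin-out i)) (trans eq (sym (lift-─⁅⁆ Q i))))

      unprotected-adjoin⁺ : ∀ i Q →
        pa H i ≡ Q ─ ⁅ i ⁆ → pa (adjoin H P) (embOut S i) ≡ lift Q ─ ⁅ embOut S i ⁆
      unprotected-adjoin⁺ i Q eq = trans (pa-adjoin-out i) (trans (cong lift eq) (lift-─⁅⁆ Q i))

      essential-adjoin⁻ : EssentialDAG (adjoin H P) → EssentialDAG H × (∀ s → Admissible H (lookup P s))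
      essential-adjoin⁻ (acyclic , protected) = (acyclic-adjoin⁻ H P acyclic , protectedH) , admissible
        where
        protectedH : ∀ a b → Edge H a b → Protected H a b
        protectedH a b e eq = protected (embOut S a) (embOut S b) (trans (edge-adjoin-out-out H P a b) e)
          (trans (unprotected-adjoin⁺ a (pa H b) eq) (cong (_─ ⁅ embOut S a ⁆) (sym (pa-adjoin-out b))))
        admissible : ∀ s → Admissible H (lookup P s)
        admissible s i (e , eq) = protected (embOut S i) (embIn S s) (trans (edge-adjoin-out-in H P i s) e)
          (trans (unprotected-adjoin⁺ i (lookup P s) eq) (cong (_─ ⁅ embOut S i ⁆) (sym (pa-adjoin-in s))))

      essential-adjoin⁺ : EssentialDAG H → (∀ s → Admissible H (lookup P s)) → EssentialDAG (adjoin H P)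
      essential-adjoin⁺ (acyclic , protectedH) admissible =
        acyclic-adjoin⁺ H P acyclic , λ a b → protected (splitView S a) (splitView S b)
        where
        protected : ∀ {a b} → SplitView S a → SplitView S b → Edge (adjoin H P) a b → Protected (adjoin H P) a b
        protected (isIn s) _ e = ⊥-elim (¬Edge-fromIn H P e)
        protected (isOut i) (isIn s) e eq = admissible s i (trans (sym (edge-adjoin-out-in H P i s)) e ,
          unprotected-adjoin⁻ i (lookup P s) (trans eq (cong (_─ ⁅ embOut S i ⁆) (pa-adjoin-in s))))
        protected (isOut i) (isOut j) e eq = protectedH i j (trans (sym (edge-adjoin-out-out H P i j)) e)
          (unprotected-adjoin⁻ i (pa H j) (trans eq (cong (_─ ⁅ embOut S i ⁆) (pa-adjoin-out j))))

open Graphs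

module Sinks where

  import Data.Bool as Bool
  open import Data.Bool using (false)
  open import Data.Bool.Properties using (¬-not)
  open import Data.Empty using (⊥-elim)
  open import Data.Fin using (Fin; zero; suc; toℕ)
  open import Data.Fin.Properties using (any?; all?; ¬∀⟶∃¬; pigeonhole)
  open import Data.Fin.Subset using (Subset; _∈_; _⊆_; Nonempty)
  open import Data.Nat using (ℕ; zero; suc; _+_)
  open import Data.Nat.GeneralisedArithmetic using (iterate)
  open import Data.Nat.Properties using (n<1+n; m≤n⇒∃[o]m+o≡n; +-suc)
  open import Data.Product using (_,_; ∃; proj₁; proj₂)
  open import Data.Vec using (tabulate)
  open import Data.Vec.Properties using (lookup∘tabulate; []=⇒lookup; lookup⇒[]=)
  open import Function using (_∘_)
  open import Relation.Binary.PropositionalEquality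
  open import Relation.Nullary using (Dec; yes; no; does)

  private variable n : ℕ

  IsSink : Graph n → Fin n → Set
  IsSink G x = ∀ y → edge G x y ≡ false

  isSink? : (G : Graph n) (x : Fin n) → Dec (IsSink G x)
  isSink? G x = all? (λ y → edge G x y Bool.≟ false)

  sinks : Graph n → Subset n
  sinks G = tabulate λ x → does (isSink? G x)

  ∈-sinks⁺ : {G : Graph n} {x : Fin n} → IsSink G x → x ∈ sinks G
  ∈-sinks⁺ {G = G} {x} sink with isSink? G x in eq
  ... | yes _ = lookup⇒[]= x (sinks G) (trans (lookup∘tabulate _ x) (cong does eq))
  ... | no ¬sink = ⊥-elim (¬sink sink)

  ∈-sinks⁻ : {G : Graph n} {x : Fin n} → x ∈ sinks G → IsSink G x
  ∈-sinks⁻ {G = G} {x} x∈sinks with isSink? G x in eq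
  ... | yes sink = sink
  ... | no _ with trans (sym (cong does eq)) (trans (sym (lookup∘tabulate _ x)) ([]=⇒lookup x∈sinks))
  ...   | ()

  iterate-+ : ∀ {A : Set} (f : A → A) x m k → iterate f x (m + k) ≡ iterate f (iterate f x m) k
  iterate-+ f x zero    k = refl
  iterate-+ f x (suc m) k = iterate-+ f (f x) m k

  -- Iterating the successor function visits n + 1 vertices within n steps, so one repeats (pigeonhole).
  successor⇒cycle : {G : Graph n} (next : Fin n → Fin n) → (∀ x → Edge G x (next x)) →
                    Fin n → ∃ λ x → Path G x x
  successor⇒cycle {n} {G} next next-edge x₀
    with i , j , i<j , revisit ← pigeonhole (n<1+n n) (λ (k : Fin (suc n)) → iterate next x₀ (toℕ k))
    with o , 1+i+o≡j ← m≤n⇒∃[o]m+o≡n i<j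
    = iterate next x₀ (toℕ i) , subst (Path G _) closes (path (iterate next x₀ (toℕ i)) o)
    where
    path : ∀ x k → Path G x (iterate next x (suc k))
    path x zero    = step (next-edge x)
    path x (suc k) = next-edge x ∷ₚ path (next x) k

    closes : iterate next (iterate next x₀ (toℕ i)) (suc o) ≡ iterate next x₀ (toℕ i)
    closes = begin
      iterate next (iterate next x₀ (toℕ i)) (suc o) ≡⟨ iterate-+ next x₀ (toℕ i) (suc o) ⟨
      iterate next x₀ (toℕ i + suc o)                ≡⟨ cong (iterate next x₀) (trans (+-suc (toℕ i) o) 1+i+o≡j) ⟩
      iterate next x₀ (toℕ j)                        ≡⟨ revisit ⟨
      iterate next x₀ (toℕ i)                        ∎
      where open ≡-Reasoning

  sink-exists : {G : Graph n} → Acyclic G → Fin n → ∃ (IsSink G)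
  sink-exists {n} {G} acyclic x₀ with any? (isSink? G)
  ... | yes sink  = sink
  ... | no noSink = ⊥-elim (acyclic _ (proj₂ (successor⇒cycle (proj₁ ∘ successor) (proj₂ ∘ successor) x₀)))
    where
    successor : ∀ x → ∃ (Edge G x)
    successor x with ¬∀⟶∃¬ n (λ y → edge G x y ≡ false) (λ y → edge G x y Bool.≟ false) (noSink ∘ (x ,_))
    ... | y , ¬e = y , ¬-not ¬e

  sinks-nonempty : (G : Graph n) → Acyclic G → Fin n → Nonempty (sinks G)
  sinks-nonempty G acyclic x₀ with sink-exists acyclic x₀
  ... | x , sink = x , ∈-sinks⁺ {G = G} sink

  module _ (S : Subset n) where
    open Adjoin S

    ⊆-sinks⇒sinksAt : {G : Graph n} → S ⊆ sinks G → SinksAt G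
    ⊆-sinks⇒sinksAt {G} S⊆sinks s = ∈-sinks⁻ {G = G} (S⊆sinks (lookup⇒[]= (embIn S s) S (lookup-embIn S s)))

    sinksAt⇒⊆-sinks : {G : Graph n} → SinksAt G → S ⊆ sinks G
    sinksAt⇒⊆-sinks {G} sinksAt {x} x∈S = member (splitView S x) x∈S
      where
      member : ∀ {x} → SplitView S x → x ∈ S → x ∈ sinks G
      member (isIn s)  _   = ∈-sinks⁺ {G = G} (sinksAt s)
      member (isOut i) i∈S with trans (sym ([]=⇒lookup i∈S)) (lookup-embOut S i)
      ... | ()

open Sinks

module Indegrees where

  import Data.Bool as Bool
  open import Data.Bool using (Bool)
  open import Data.Fin using (suc)
  open import Data.Fin.Subset using (Subset; inside; outside; ∁; ∣_∣)
  open import Data.List using (List; []; _∷_; length; filter; allFin)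
  open import Data.Nat as ℕ using (ℕ; suc; _+_; _*_)
  import Data.Nat.Properties as ℕₚ
  open import Data.Vec using (Vec; []; _∷_; lookup)
  open import Relation.Binary.PropositionalEquality
  open import Relation.Nullary using (yes; no)
  open import Relation.Unary using (Decidable)

  private variable n : ℕ

  open ℕΣ hiding (_+_; _*_)

  length-filter≡∑ : ∀ {B : Set} {P : B → Set} (P? : Decidable P) (xs : List B) →
                  length (filter P? xs) ≡ ∑[ x ← xs ] 𝟙 (P? x)
  length-filter≡∑ P? []       = refl
  length-filter≡∑ P? (x ∷ xs) with P? x
  ... | yes _ = cong suc (length-filter≡∑ P? xs)
  ... | no _  = length-filter≡∑ P? xs

  ∣∣≡∑ : (v : Subset n) → ∣ v ∣ ≡ ∑[ x ← allFin n ] 𝟙 (lookup v x Bool.≟ inside)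
  ∣∣≡∑ []            = refl
  ∣∣≡∑ (inside ∷ v)  =
    trans (cong suc (∣∣≡∑ v)) (sym (∑-allFin-suc _ (λ x → 𝟙 (lookup (inside ∷ v) x Bool.≟ inside))))
  ∣∣≡∑ (outside ∷ v) =
    trans (∣∣≡∑ v) (sym (∑-allFin-suc _ (λ x → 𝟙 (lookup (outside ∷ v) x Bool.≟ inside))))

  numIndeg≡∑ : (G : Graph n) (t : ℕ) → numIndeg G t ≡ ∑[ x ← allFin n ] 𝟙 (indeg G x ℕ.≟ t)
  numIndeg≡∑ G t = length-filter≡∑ (λ x → indeg G x ℕ.≟ t) (allFin _)

  module _ (S : Subset n) where
    open Adjoin S

    ∣lift∣ : ∀ v → ∣ lift v ∣ ≡ ∣ v ∣
    ∣lift∣ v = begin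
      ∣ lift v ∣
        ≡⟨ ∣∣≡∑ (lift v) ⟩
      ∑[ x ← allFin _ ] 𝟙 (lookup (lift v) x Bool.≟ inside)
        ≡⟨ ∑-allFin-split S _ ⟩
      ∑[ s ← allFin ∣ S ∣ ] 𝟙 (lookup (lift v) (embIn S s) Bool.≟ inside)
        + ∑[ i ← allFin ∣ ∁ S ∣ ] 𝟙 (lookup (lift v) (embOut S i) Bool.≟ inside)
          ≡⟨ cong₂ _+_ (∑-zero (allFin ∣ S ∣) (λ s → cong isInside (lookup-lift-in v s)))
                       (∑-cong (allFin ∣ ∁ S ∣) (λ i → cong isInside (lookup-lift-out v i))) ⟩
      ∑[ i ← allFin ∣ ∁ S ∣ ] 𝟙 (lookup v i Bool.≟ inside)
        ≡⟨ ∣∣≡∑ v ⟨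
      ∣ v ∣ ∎
      where
      open ≡-Reasoning
      isInside : Bool → ℕ
      isInside b = 𝟙 (b Bool.≟ inside)

    module _ (H : Graph ∣ ∁ S ∣) (P : Vec (Subset ∣ ∁ S ∣) ∣ S ∣) where

      indeg-adjoin-out : ∀ j → indeg (adjoin H P) (embOut S j) ≡ indeg H j
      indeg-adjoin-out j = trans (cong ∣_∣ (pa-adjoin-out H P j)) (∣lift∣ (pa H j))

      indeg-adjoin-in : ∀ s → indeg (adjoin H P) (embIn S s) ≡ ∣ lookup P s ∣
      indeg-adjoin-in s = trans (cong ∣_∣ (pa-adjoin-in H P s)) (∣lift∣ (lookup P s))

      numIndeg-adjoin : ∀ t →
        numIndeg (adjoin H P) t ≡ ∑[ s ← allFin ∣ S ∣ ] 𝟙 (∣ lookup P s ∣ ℕ.≟ t) + numIndeg H t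
      numIndeg-adjoin t = begin
        numIndeg (adjoin H P) t
          ≡⟨ numIndeg≡∑ (adjoin H P) t ⟩
        ∑[ x ← allFin _ ] 𝟙 (indeg (adjoin H P) x ℕ.≟ t)
          ≡⟨ ∑-allFin-split S _ ⟩
        ∑[ s ← allFin ∣ S ∣ ] 𝟙 (indeg (adjoin H P) (embIn S s) ℕ.≟ t)
          + ∑[ i ← allFin ∣ ∁ S ∣ ] 𝟙 (indeg (adjoin H P) (embOut S i) ℕ.≟ t)
            ≡⟨ cong₂ _+_ (∑-cong (allFin ∣ S ∣) (λ s → cong (λ a → 𝟙 (a ℕ.≟ t)) (indeg-adjoin-in s)))
                         (∑-cong (allFin ∣ ∁ S ∣) (λ i → cong (λ a → 𝟙 (a ℕ.≟ t)) (indeg-adjoin-out i))) ⟩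
        ∑[ s ← allFin ∣ S ∣ ] 𝟙 (∣ lookup P s ∣ ℕ.≟ t)
          + ∑[ i ← allFin ∣ ∁ S ∣ ] 𝟙 (indeg H i ℕ.≟ t)
            ≡⟨ cong (∑[ s ← allFin ∣ S ∣ ] 𝟙 (∣ lookup P s ∣ ℕ.≟ t) +_) (numIndeg≡∑ H t) ⟨
        ∑[ s ← allFin ∣ S ∣ ] 𝟙 (∣ lookup P s ∣ ℕ.≟ t) + numIndeg H t ∎
        where open ≡-Reasoning

open Indegrees

module AdmissibleParentSets where

  import Data.Bool as Bool
  open import Data.Bool using (_∨_)
  open import Data.Bool.Properties using (∨-zeroʳ; ∨-identityʳ)
  open import Data.Empty using (⊥-elim)
  open import Data.Fin as Fin using (Fin; zero; suc)
  import Data.Fin.Properties as Finₚ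
  open import Data.Fin.Subset using (Subset; inside; outside; ⁅_⁆; _─_; _∪_; ∣_∣)
  import Data.Fin.Subset.Properties as Subsetₚ
  open import Data.List using (_∷_; allFin)
  open import Data.Nat as ℕ using (ℕ; zero; suc; _+_; _*_)
  open import Data.Nat.Combinatorics using (_C_; nCk+nC[k+1]≡[n+1]C[k+1])
  import Data.Nat.Properties as ℕₚ
  open import Data.Product using (_,_)
  open import Data.Vec using (_∷_; lookup)
  import Data.Vec.Properties as Vecₚ
  open import Function using (_∘_)
  open import Relation.Binary.PropositionalEquality
  open import Relation.Nullary using (Dec; yes; no; _×-dec_; ¬?)

  private variable n : ℕ

  open ℕΣ hiding (_+_; _*_)

  _≟ˢ_ : (p q : Subset n) → Dec (p ≡ q)
  _≟ˢ_ = Vecₚ.≡-dec Bool._≟_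

  allSubsets-isEnumeration : ∀ n → IsEnumeration _≟ˢ_ (allSubsets n)
  allSubsets-isEnumeration = allVecs-isEnumeration bools-isEnumeration

  subsets-of-size≡C : ∀ k t → ∑[ Q ← allSubsets k ] 𝟙 (∣ Q ∣ ℕ.≟ t) ≡ k C t
  subsets-of-size≡C zero    zero    = refl
  subsets-of-size≡C zero    (suc t) = refl
  subsets-of-size≡C (suc k) t = trans (∑-allSubsets-suc k _) (by-size t)
    where
    by-size : ∀ t → ∑[ Q ← allSubsets k ] 𝟙 (suc ∣ Q ∣ ℕ.≟ t)
                      + ∑[ Q ← allSubsets k ] 𝟙 (∣ Q ∣ ℕ.≟ t) ≡ suc k C t
    by-size zero    = cong₂ _+_ (∑-zero (allSubsets k) (λ Q → refl)) (subsets-of-size≡C k zero)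
    by-size (suc t) = trans (cong₂ _+_ (trans (∑-cong (allSubsets k) shift) (subsets-of-size≡C k t))
                                       (subsets-of-size≡C k (suc t)))
                            (nCk+nC[k+1]≡[n+1]C[k+1] k t)
      where
      shift : ∀ Q → 𝟙 (suc ∣ Q ∣ ℕ.≟ suc t) ≡ 𝟙 (∣ Q ∣ ℕ.≟ t)
      shift Q = 𝟙-⇔ (suc ∣ Q ∣ ℕ.≟ suc t) (∣ Q ∣ ℕ.≟ t) ℕₚ.suc-injective (cong suc)

  unprotecting? : (H : Graph n) (Q : Subset n) (i : Fin n) → Dec (Unprotecting H Q i)
  unprotecting? H Q i = (lookup Q i Bool.≟ inside) ×-dec (pa H i ≟ˢ (Q ─ ⁅ i ⁆))

  admissible? : (H : Graph n) (Q : Subset n) → Dec (Admissible H Q)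
  admissible? H Q = Finₚ.all? (λ i → ¬? (unprotecting? H Q i))

  lookup-∪ : (p q : Subset n) (x : Fin n) → lookup (p ∪ q) x ≡ lookup p x ∨ lookup q x
  lookup-∪ p q x = Vecₚ.lookup-zipWith _∨_ x p q

  ∣∪⁅x⁆∣ : (p : Subset n) (x : Fin n) → lookup p x ≡ outside → ∣ p ∪ ⁅ x ⁆ ∣ ≡ suc ∣ p ∣
  ∣∪⁅x⁆∣ (outside ∷ p) zero    _  = cong (suc ∘ ∣_∣) (Subsetₚ.∪-identityʳ p)
  ∣∪⁅x⁆∣ (inside  ∷ p) (suc x) eq = cong suc (∣∪⁅x⁆∣ p x eq)
  ∣∪⁅x⁆∣ (outside ∷ p) (suc x) eq = ∣∪⁅x⁆∣ p x eq

  -- In an acyclic graph a subset Q is unprotecting at i exactly when Q = pa(i) ∪ {i}, and then i is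
  -- the only such vertex: two of them would be parents of each other.
  module AdmissibleCount {k : ℕ} (H : Graph k) (acyclic : Acyclic H) where

    i∉pa[i] : ∀ i → lookup (pa H i) i ≡ outside
    i∉pa[i] i with lookup (pa H i) i in eq
    ... | outside = refl
    ... | inside  = ⊥-elim (acyclic i (step (trans (sym (lookup-pa H i i)) eq)))

    pa∪self : Fin k → Subset k
    pa∪self i = pa H i ∪ ⁅ i ⁆

    lookup-pa∪self : ∀ i x → lookup (pa∪self i) x ≡ lookup (pa H i) x ∨ lookup ⁅ i ⁆ x
    lookup-pa∪self i x = lookup-∪ (pa H i) ⁅ i ⁆ x

    unprotecting⇒≡pa∪self : ∀ {Q i} → Unprotecting H Q i → pa∪self i ≡ Q
    unprotecting⇒≡pa∪self {Q} {i} (i∈Q , pa≡Q-i) = lookup-ext agree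
      where
      agree : ∀ x → lookup (pa∪self i) x ≡ lookup Q x
      agree x with x Fin.≟ i
      ... | yes refl = trans (lookup-pa∪self i i)
        (trans (cong (lookup (pa H i) i ∨_) (lookup-⁅x⁆ i)) (trans (∨-zeroʳ _) (sym i∈Q)))
      ... | no x≢i = trans (lookup-pa∪self i x)
        (trans (cong (lookup (pa H i) x ∨_) (lookup-⁅y⁆ x≢i)) (trans (∨-identityʳ _)
        (trans (cong (λ p → lookup p x) pa≡Q-i) (lookup-─⁅y⁆ Q x≢i))))

    ≡pa∪self⇒unprotecting : ∀ {Q i} → pa∪self i ≡ Q → Unprotecting H Q i
    ≡pa∪self⇒unprotecting {i = i} refl = i∈pa∪self , lookup-ext agree
      where
      i∈pa∪self : lookup (pa∪self i) i ≡ inside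
      i∈pa∪self = trans (lookup-pa∪self i i) (trans (cong (lookup (pa H i) i ∨_) (lookup-⁅x⁆ i)) (∨-zeroʳ _))
      agree : ∀ x → lookup (pa H i) x ≡ lookup (pa∪self i ─ ⁅ i ⁆) x
      agree x with x Fin.≟ i
      ... | yes refl = trans (i∉pa[i] i) (sym (lookup-─⁅x⁆ (pa∪self i) i))
      ... | no x≢i = sym (trans (lookup-─⁅y⁆ (pa∪self i) x≢i)
        (trans (lookup-pa∪self i x) (trans (cong (lookup (pa H i) x ∨_) (lookup-⁅y⁆ x≢i)) (∨-identityʳ _))))

    unprotecting-unique : ∀ {Q i j} → Unprotecting H Q i → Unprotecting H Q j → i ≡ j
    unprotecting-unique {Q} {i} {j} (i∈Q , pa[i]≡) (j∈Q , pa[j]≡) with i Fin.≟ j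
    ... | yes i≡j = i≡j
    ... | no i≢j =
      ⊥-elim (acyclic i (edge-between i≢j pa[j]≡ i∈Q ∷ₚ step (edge-between (i≢j ∘ sym) pa[i]≡ j∈Q)))
      where
      edge-between : ∀ {a b} → a ≢ b → pa H b ≡ Q ─ ⁅ b ⁆ → lookup Q a ≡ inside → Edge H a b
      edge-between {a} {b} a≢b pa[b]≡ a∈Q =
        trans (sym (lookup-pa H b a)) (trans (cong (λ p → lookup p a) pa[b]≡) (trans (lookup-─⁅y⁆ Q a≢b) a∈Q))

    admissible+unprotecting≡1 : ∀ Q →
      𝟙 (admissible? H Q) + ∑[ i ← allFin k ] 𝟙 (unprotecting? H Q i) ≡ 1
    admissible+unprotecting≡1 Q with admissible? H Q
    ... | yes admissible = cong suc (∑-zero (allFin k) (λ i → 𝟙-no (unprotecting? H Q i) (admissible i)))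
    ... | no ¬admissible with Finₚ.¬∀⟶∃¬ k _ (λ i → ¬? (unprotecting? H Q i)) ¬admissible
    ...   | i₀ , ¬¬unprotecting = trans
      (∑-cong (allFin k) (λ j → 𝟙-⇔ (unprotecting? H Q j) (i₀ Fin.≟ j)
        (unprotecting-unique unprotecting₀) (λ { refl → unprotecting₀ })))
      (occurs-once (allFin-isEnumeration k) i₀)
      where
      unprotecting₀ : Unprotecting H Q i₀
      unprotecting₀ with unprotecting? H Q i₀
      ... | yes u = u
      ... | no ¬u = ⊥-elim (¬¬unprotecting ¬u)

    previousCount : ℕ → ℕ
    previousCount zero    = 0
    previousCount (suc t) = numIndeg H t

    admissibleCount : ℕ → ℕ
    admissibleCount t = ∑[ Q ← allSubsets k ] (𝟙 (∣ Q ∣ ℕ.≟ t) * 𝟙 (admissible? H Q))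

    ∑-unprotecting-of-size : ∀ i t →
      ∑[ Q ← allSubsets k ] (𝟙 (∣ Q ∣ ℕ.≟ t) * 𝟙 (unprotecting? H Q i)) ≡ 𝟙 (suc (indeg H i) ℕ.≟ t)
    ∑-unprotecting-of-size i t = begin
      ∑[ Q ← allSubsets k ] (𝟙 (∣ Q ∣ ℕ.≟ t) * 𝟙 (unprotecting? H Q i))
        ≡⟨ ∑-cong (allSubsets k) (λ Q → trans (ℕₚ.*-comm (𝟙 (∣ Q ∣ ℕ.≟ t)) _)
             (cong (_* 𝟙 (∣ Q ∣ ℕ.≟ t)) (𝟙-⇔ (unprotecting? H Q i) (pa∪self i ≟ˢ Q)
               unprotecting⇒≡pa∪self ≡pa∪self⇒unprotecting))) ⟩
      ∑[ Q ← allSubsets k ] (𝟙 (pa∪self i ≟ˢ Q) * 𝟙 (∣ Q ∣ ℕ.≟ t))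
        ≡⟨ ∑-select _≟ˢ_ (allSubsets-isEnumeration k) (pa∪self i) (λ Q → 𝟙 (∣ Q ∣ ℕ.≟ t)) ⟩
      𝟙 (∣ pa∪self i ∣ ℕ.≟ t)
        ≡⟨ cong (λ a → 𝟙 (a ℕ.≟ t)) (∣∪⁅x⁆∣ (pa H i) i (i∉pa[i] i)) ⟩
      𝟙 (suc (indeg H i) ℕ.≟ t) ∎
      where open ≡-Reasoning

    previousCount≡∑ : ∀ t → ∑[ i ← allFin k ] 𝟙 (suc (indeg H i) ℕ.≟ t) ≡ previousCount t
    previousCount≡∑ zero    = ∑-zero (allFin k) (λ i → refl)
    previousCount≡∑ (suc t) = trans
      (∑-cong (allFin k) (λ i →
        𝟙-⇔ (suc (indeg H i) ℕ.≟ suc t) (indeg H i ℕ.≟ t) ℕₚ.suc-injective (cong suc)))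
      (sym (numIndeg≡∑ H t))

    admissibleCount+previousCount : ∀ t → admissibleCount t + previousCount t ≡ k C t
    admissibleCount+previousCount t = begin
      admissibleCount t + previousCount t
        ≡⟨ cong (admissibleCount t +_) (sym (previousCount≡∑ t)) ⟩
      admissibleCount t + ∑[ i ← allFin k ] 𝟙 (suc (indeg H i) ℕ.≟ t)
        ≡⟨ cong (admissibleCount t +_) (∑-cong (allFin k) (λ i → sym (∑-unprotecting-of-size i t))) ⟩
      admissibleCount t + ∑[ i ← allFin k ] ∑[ Q ← allSubsets k ] (ofSize Q * unprotectingAt Q i)
        ≡⟨ cong (admissibleCount t +_) (∑-comm (allFin k) (allSubsets k) _) ⟩
      admissibleCount t + ∑[ Q ← allSubsets k ] ∑[ i ← allFin k ] (ofSize Q * unprotectingAt Q i)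
        ≡⟨ cong (admissibleCount t +_) (∑-cong (allSubsets k) (λ Q → sym (*-distribˡ-∑ (allFin k) (ofSize Q) _))) ⟩
      admissibleCount t + ∑[ Q ← allSubsets k ] (ofSize Q * ∑[ i ← allFin k ] unprotectingAt Q i)
        ≡⟨ ∑-distrib-+ (allSubsets k) _ _ ⟨
      ∑[ Q ← allSubsets k ] (ofSize Q * 𝟙 (admissible? H Q) + ofSize Q * ∑[ i ← allFin k ] unprotectingAt Q i)
        ≡⟨ ∑-cong (allSubsets k) (λ Q → sym (ℕₚ.*-distribˡ-+ (ofSize Q) _ _)) ⟩
      ∑[ Q ← allSubsets k ] (ofSize Q * (𝟙 (admissible? H Q) + ∑[ i ← allFin k ] unprotectingAt Q i))
        ≡⟨ ∑-cong (allSubsets k) (λ Q →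
             trans (cong (ofSize Q *_) (admissible+unprotecting≡1 Q)) (ℕₚ.*-identityʳ _)) ⟩
      ∑[ Q ← allSubsets k ] ofSize Q
        ≡⟨ subsets-of-size≡C k t ⟩
      k C t ∎
      where
      open ≡-Reasoning
      ofSize : Subset k → ℕ
      ofSize Q = 𝟙 (∣ Q ∣ ℕ.≟ t)
      unprotectingAt : Subset k → Fin k → ℕ
      unprotectingAt Q i = 𝟙 (unprotecting? H Q i)

open AdmissibleParentSets

module Multinomials where

  open import Algebra.Properties.CommutativeSemigroup ℕₚ.*-commutativeSemigroup using (x∙yz≈y∙xz)
  open import Data.Fin as Fin using (Fin; zero; suc; toℕ; fromℕ<)
  import Data.Fin.Properties as Finₚ
  open import Data.List using (List; []; _∷_; allFin)
  open import Data.Nat as ℕ using (ℕ; zero; suc; _+_; _*_; _^_; _≤_; _<_; pred; _!; s≤s; z≤n)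
  open import Data.Nat.Combinatorics using (k![n∸k]!∣n!)
  import Data.Nat.DivMod as DivMod
  open import Data.Nat.Divisibility using (_∣_; *-monoʳ-∣; ∣-refl; ∣-trans)
  import Data.Nat.Properties as ℕₚ
  open import Data.Nat.Tactic.RingSolver using (solve-∀)
  open import Data.Product using (_×_; _,_)
  open import Data.Vec using (Vec; []; _∷_; lookup; tabulate; updateAt)
  import Data.Vec.Properties as Vecₚ
  open import Function using (_∘_)
  open import Relation.Binary.PropositionalEquality
  open import Relation.Nullary using (¬_; Dec; yes; no; _×-dec_)

  open ℕΣ hiding (_+_; _*_)

  private variable D : ℕ

  _≟ᵥ_ : (a b : Vec ℕ D) → Dec (a ≡ b)
  _≟ᵥ_ = Vecₚ.≡-dec ℕ._≟_

  ∣tabulate∣ᵥ : (f : Fin D → ℕ) → ∣ tabulate f ∣ᵥ ≡ ∑ (allFin D) f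
  ∣tabulate∣ᵥ {zero}  f = refl
  ∣tabulate∣ᵥ {suc D} f = trans (cong (f zero +_) (∣tabulate∣ᵥ (f ∘ suc))) (sym (∑-allFin-suc D f))

  ∣∣ᵥ≡∑ : (a : Vec ℕ D) → ∣ a ∣ᵥ ≡ ∑ (allFin D) (lookup a)
  ∣∣ᵥ≡∑ a = trans (cong ∣_∣ᵥ (sym (Vecₚ.tabulate∘lookup a))) (∣tabulate∣ᵥ (lookup a))

  ∣∣ᵥ≡0⇒lookup≡0 : (a : Vec ℕ D) → ∣ a ∣ᵥ ≡ 0 → ∀ t → lookup a t ≡ 0
  ∣∣ᵥ≡0⇒lookup≡0 (zero ∷ a) eq zero    = refl
  ∣∣ᵥ≡0⇒lookup≡0 (zero ∷ a) eq (suc t) = ∣∣ᵥ≡0⇒lookup≡0 a eq t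

  ∣∣ᵥ≡0⇒prodFact≡1 : (a : Vec ℕ D) → ∣ a ∣ᵥ ≡ 0 → prodFact a ≡ 1
  ∣∣ᵥ≡0⇒prodFact≡1 []       eq = refl
  ∣∣ᵥ≡0⇒prodFact≡1 (zero ∷ a) eq = trans (ℕₚ.+-identityʳ _) (∣∣ᵥ≡0⇒prodFact≡1 a eq)

  prodFact∣∣∣ᵥ! : (a : Vec ℕ D) → prodFact a ∣ ∣ a ∣ᵥ !
  prodFact∣∣∣ᵥ! []       = ∣-refl
  prodFact∣∣∣ᵥ! (x ∷ a) = ∣-trans (*-monoʳ-∣ (x !) (prodFact∣∣∣ᵥ! a))
    (subst (λ r → x ! * r ! ∣ (x + ∣ a ∣ᵥ) !) (ℕₚ.m+n∸m≡n x ∣ a ∣ᵥ)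
      (k![n∸k]!∣n! (ℕₚ.m≤m+n x ∣ a ∣ᵥ)))

  ∑-𝟙-≟toℕ≤1 : ∀ x → ∑[ u ← allFin D ] 𝟙 (x ℕ.≟ toℕ u) ≤ 1
  ∑-𝟙-≟toℕ≤1 {D} x with x ℕ.<? D
  ... | yes x<D = ℕₚ.≤-reflexive (trans (∑-cong (allFin D) (λ u → sym (ℕₚ.*-identityʳ _)))
                                       (∑-select-toℕ x x<D (λ _ → 1)))
  ... | no x≮D  = ℕₚ.≤-trans (ℕₚ.≤-reflexive (trans (∑-cong (allFin D) (λ u → sym (ℕₚ.*-identityʳ _)))
                                                  (∑-select-toℕ-≥ x x≮D (λ _ → 1))))
                             z≤n

  module _ {D : ℕ} (a : Vec ℕ D) (u : Fin D) (1≤aᵤ : 1 ≤ lookup a u) where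

    ∣updateAt-pred∣ᵥ : suc ∣ updateAt a u pred ∣ᵥ ≡ ∣ a ∣ᵥ
    ∣updateAt-pred∣ᵥ = go a u 1≤aᵤ
      where
      go : ∀ {D} (a : Vec ℕ D) u → 1 ≤ lookup a u → suc ∣ updateAt a u pred ∣ᵥ ≡ ∣ a ∣ᵥ
      go (suc x ∷ a) zero    _ = refl
      go (x ∷ a)     (suc u) p = trans (sym (ℕₚ.+-suc x _)) (cong (x +_) (go a u p))

    prodFact-updateAt-pred : lookup a u * prodFact (updateAt a u pred) ≡ prodFact a
    prodFact-updateAt-pred = go a u 1≤aᵤ
      where
      go : ∀ {D} (a : Vec ℕ D) u → 1 ≤ lookup a u → lookup a u * prodFact (updateAt a u pred) ≡ prodFact a
      go (suc x ∷ a) zero    _ = sym (ℕₚ.*-assoc (suc x) (x !) (prodFact a))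
      go (x ∷ a)     (suc u) p = trans (x∙yz≈y∙xz (lookup a u) (x !) _) (cong (x ! *_) (go a u p))

    ∏^-updateAt-pred : (c : Fin D → ℕ) →
      c u * ∏[ t ← allFin D ] (c t ^ lookup (updateAt a u pred) t) ≡ ∏[ t ← allFin D ] (c t ^ lookup a t)
    ∏^-updateAt-pred = go a u 1≤aᵤ
      where
      go : ∀ {D} (a : Vec ℕ D) u → 1 ≤ lookup a u → (c : Fin D → ℕ) →
           c u * ∏[ t ← allFin D ] (c t ^ lookup (updateAt a u pred) t) ≡ ∏[ t ← allFin D ] (c t ^ lookup a t)
      go {suc D} (suc x ∷ a) zero p c = begin
        c zero * ∏ (allFin (suc D)) (λ t → c t ^ lookup (x ∷ a) t)
          ≡⟨ cong (c zero *_) (∏-allFin-suc D (λ t → c t ^ lookup (x ∷ a) t)) ⟩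
        c zero * (c zero ^ x * ∏[ t ← allFin D ] (c (suc t) ^ lookup a t))
          ≡⟨ ℕₚ.*-assoc (c zero) _ _ ⟨
        c zero ^ suc x * ∏[ t ← allFin D ] (c (suc t) ^ lookup a t)
          ≡⟨ ∏-allFin-suc D (λ t → c t ^ lookup (suc x ∷ a) t) ⟨
        ∏ (allFin (suc D)) (λ t → c t ^ lookup (suc x ∷ a) t) ∎
        where open ≡-Reasoning
      go {suc D} (x ∷ a) (suc u) p c = begin
        c (suc u) * ∏ (allFin (suc D)) (λ t → c t ^ lookup (x ∷ updateAt a u pred) t)
          ≡⟨ cong (c (suc u) *_) (∏-allFin-suc D (λ t → c t ^ lookup (x ∷ updateAt a u pred) t)) ⟩
        c (suc u) * (c zero ^ x * ∏[ t ← allFin D ] (c (suc t) ^ lookup (updateAt a u pred) t))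
          ≡⟨ x∙yz≈y∙xz (c (suc u)) (c zero ^ x) _ ⟩
        c zero ^ x * (c (suc u) * ∏[ t ← allFin D ] (c (suc t) ^ lookup (updateAt a u pred) t))
          ≡⟨ cong (c zero ^ x *_) (go a u p (c ∘ suc)) ⟩
        c zero ^ x * ∏[ t ← allFin D ] (c (suc t) ^ lookup a t)
          ≡⟨ ∏-allFin-suc D (λ t → c t ^ lookup (x ∷ a) t) ⟨
        ∏ (allFin (suc D)) (λ t → c t ^ lookup (x ∷ a) t) ∎
        where open ≡-Reasoning

  -- Vectors P ∈ objectsᵐ, weighted by the product of the weights of their entries and classified by
  -- the histogram of the types of their entries; types ≥ D are not recorded.
  module WeightedMultinomial {O : Set} (objects : List O) (type : O → ℕ) (weight : O → ℕ) (D : ℕ) where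

    typeCount : ∀ {m} → Fin D → Vec O m → ℕ
    typeCount u []      = 0
    typeCount u (Q ∷ P) = 𝟙 (type Q ℕ.≟ toℕ u) + typeCount u P

    histogram : ∀ {m} → Vec O m → Vec ℕ D
    histogram P = tabulate λ u → typeCount u P

    weightProduct : ∀ {m} → Vec O m → ℕ
    weightProduct []      = 1
    weightProduct (Q ∷ P) = weight Q * weightProduct P

    typeWeight : Fin D → ℕ
    typeWeight u = ∑[ Q ← objects ] (𝟙 (type Q ℕ.≟ toℕ u) * weight Q)

    count : ℕ → Vec ℕ D → ℕ
    count m a = ∑[ P ← allVecs objects m ] (𝟙 (histogram P ≟ᵥ a) * weightProduct P)

    monomial : Vec ℕ D → ℕ
    monomial a = ∏[ u ← allFin D ] (typeWeight u ^ lookup a u)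

    lookup-histogram : ∀ {m} (P : Vec O m) u → lookup (histogram P) u ≡ typeCount u P
    lookup-histogram P u = Vecₚ.lookup∘tabulate (λ u → typeCount u P) u

    typeCount≡∑ : ∀ {m} (u : Fin D) (P : Vec O m) →
      typeCount u P ≡ ∑[ s ← allFin m ] 𝟙 (type (lookup P s) ℕ.≟ toℕ u)
    typeCount≡∑ u []      = refl
    typeCount≡∑ u (Q ∷ P) = trans (cong (𝟙 (type Q ℕ.≟ toℕ u) +_) (typeCount≡∑ u P))
      (sym (∑-allFin-suc _ (λ s → 𝟙 (type (lookup (Q ∷ P) s) ℕ.≟ toℕ u))))

    ∣histogram∣ᵥ≡∑ : ∀ {m} (P : Vec O m) → ∣ histogram P ∣ᵥ ≡ ∑[ u ← allFin D ] typeCount u P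
    ∣histogram∣ᵥ≡∑ P = ∣tabulate∣ᵥ (λ u → typeCount u P)

    ∣histogram∣ᵥ≤ : ∀ {m} (P : Vec O m) → ∣ histogram P ∣ᵥ ≤ m
    ∣histogram∣ᵥ≤ []      = ℕₚ.≤-reflexive (trans (∣histogram∣ᵥ≡∑ []) (∑-zero (allFin D) (λ _ → refl)))
    ∣histogram∣ᵥ≤ (Q ∷ P) = begin
      ∣ histogram (Q ∷ P) ∣ᵥ
        ≡⟨ ∣histogram∣ᵥ≡∑ (Q ∷ P) ⟩
      ∑[ u ← allFin D ] (𝟙 (type Q ℕ.≟ toℕ u) + typeCount u P)
        ≡⟨ ∑-distrib-+ (allFin D) _ _ ⟩
      ∑[ u ← allFin D ] 𝟙 (type Q ℕ.≟ toℕ u) + ∑[ u ← allFin D ] typeCount u P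
        ≤⟨ ℕₚ.+-monoˡ-≤ _ (∑-𝟙-≟toℕ≤1 {D} (type Q)) ⟩
      1 + ∑[ u ← allFin D ] typeCount u P
        ≡⟨ cong suc (∣histogram∣ᵥ≡∑ P) ⟨
      1 + ∣ histogram P ∣ᵥ
        ≤⟨ s≤s (∣histogram∣ᵥ≤ P) ⟩
      suc _ ∎
      where open ℕₚ.≤-Reasoning

    module _ {m : ℕ} (Q : O) (P : Vec O m) (u₀ : Fin D) (typeQ≡u₀ : type Q ≡ toℕ u₀) where

      lookup-histogram-∷ : ∀ t → lookup (histogram (Q ∷ P)) t ≡ 𝟙 (u₀ Fin.≟ t) + lookup (histogram P) t
      lookup-histogram-∷ t = trans (Vecₚ.lookup∘tabulate _ t) (cong₂ _+_
        (𝟙-⇔ (type Q ℕ.≟ toℕ t) (u₀ Fin.≟ t)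
          (λ eq → Finₚ.toℕ-injective (trans (sym typeQ≡u₀) eq)) (λ { refl → typeQ≡u₀ }))
        (sym (Vecₚ.lookup∘tabulate _ t)))

      histogram-∷⁻ : ∀ {a} → histogram (Q ∷ P) ≡ a → 1 ≤ lookup a u₀ × histogram P ≡ updateAt a u₀ pred
      histogram-∷⁻ refl = subst (1 ≤_) (sym (lookup-at-u₀)) (s≤s z≤n) , lookup-ext agree
        where
        lookup-at-u₀ : lookup (histogram (Q ∷ P)) u₀ ≡ suc (lookup (histogram P) u₀)
        lookup-at-u₀ = trans (lookup-histogram-∷ u₀) (cong (_+ lookup (histogram P) u₀) (𝟙-yes (u₀ Fin.≟ u₀) refl))
        agree : ∀ t → lookup (histogram P) t ≡ lookup (updateAt (histogram (Q ∷ P)) u₀ pred) t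
        agree t with t Fin.≟ u₀
        ... | yes refl = sym (trans (Vecₚ.lookup∘updateAt u₀ (histogram (Q ∷ P))) (cong pred lookup-at-u₀))
        ... | no t≢u₀ = sym (trans (Vecₚ.lookup∘updateAt′ t u₀ t≢u₀ (histogram (Q ∷ P)))
          (trans (lookup-histogram-∷ t) (cong (_+ lookup (histogram P) t) (𝟙-no (u₀ Fin.≟ t) (t≢u₀ ∘ sym)))))

      histogram-∷⁺ : ∀ {a} → 1 ≤ lookup a u₀ × histogram P ≡ updateAt a u₀ pred → histogram (Q ∷ P) ≡ a
      histogram-∷⁺ {a} (1≤a[u₀] , hist≡) = lookup-ext agree
        where
        agree : ∀ t → lookup (histogram (Q ∷ P)) t ≡ lookup a t
        agree t with t Fin.≟ u₀
        ... | yes refl = begin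
          lookup (histogram (Q ∷ P)) u₀
            ≡⟨ lookup-histogram-∷ u₀ ⟩
          𝟙 (u₀ Fin.≟ u₀) + lookup (histogram P) u₀
            ≡⟨ cong₂ _+_ (𝟙-yes (u₀ Fin.≟ u₀) refl) (cong (λ v → lookup v u₀) hist≡) ⟩
          suc (lookup (updateAt a u₀ pred) u₀)
            ≡⟨ cong suc (Vecₚ.lookup∘updateAt u₀ a) ⟩
          suc (pred (lookup a u₀))
            ≡⟨ ℕₚ.suc-pred (lookup a u₀) ⦃ ℕ.>-nonZero 1≤a[u₀] ⦄ ⟩
          lookup a u₀ ∎
          where open ≡-Reasoning
        ... | no t≢u₀ = begin
          lookup (histogram (Q ∷ P)) t
            ≡⟨ lookup-histogram-∷ t ⟩
          𝟙 (u₀ Fin.≟ t) + lookup (histogram P) t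
            ≡⟨ cong₂ _+_ (𝟙-no (u₀ Fin.≟ t) (t≢u₀ ∘ sym)) (cong (λ v → lookup v t) hist≡) ⟩
          lookup (updateAt a u₀ pred) t
            ≡⟨ Vecₚ.lookup∘updateAt′ t u₀ t≢u₀ a ⟩
          lookup a t ∎
          where open ≡-Reasoning

    histogram-∷-≥ : ∀ {m} (Q : O) (P : Vec O m) → ¬ type Q ℕ.< D → histogram (Q ∷ P) ≡ histogram P
    histogram-∷-≥ Q P typeQ≮D = lookup-ext λ t → trans (lookup-histogram (Q ∷ P) t) (trans
      (cong (_+ typeCount t P)
        (𝟙-no (type Q ℕ.≟ toℕ t) (λ eq → typeQ≮D (subst (ℕ._< D) (sym eq) (Finₚ.toℕ<n t)))))
      (sym (lookup-histogram P t)))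

    countMinus : ℕ → Vec ℕ D → Fin D → ℕ
    countMinus m a u = 𝟙 (1 ℕ.≤? lookup a u) * count m (updateAt a u pred)

    count-∷ : ∀ {m} (a : Vec ℕ D) → ∣ a ∣ᵥ ≡ suc m → (Q : O) →
      ∑[ P ← allVecs objects m ] (𝟙 (histogram (Q ∷ P) ≟ᵥ a) * (weight Q * weightProduct P))
      ≡ ∑[ u ← allFin D ] (𝟙 (type Q ℕ.≟ toℕ u) * (weight Q * countMinus m a u))
    count-∷ {m} a ∣a∣≡1+m Q with type Q ℕ.<? D
    ... | yes typeQ<D = begin
      ∑[ P ← allVecs objects m ] (𝟙 (histogram (Q ∷ P) ≟ᵥ a) * (weight Q * weightProduct P))
        ≡⟨ ∑-cong (allVecs objects m) (λ P → cong (_* (weight Q * weightProduct P)) (trans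
             (𝟙-⇔ (histogram (Q ∷ P) ≟ᵥ a) (1≤a[u₀]? ×-dec (histogram P ≟ᵥ a′))
                  (histogram-∷⁻ Q P u₀ typeQ≡u₀) (histogram-∷⁺ Q P u₀ typeQ≡u₀))
             (𝟙-× 1≤a[u₀]? (histogram P ≟ᵥ a′)))) ⟩
      ∑[ P ← allVecs objects m ] (𝟙 1≤a[u₀]? * 𝟙 (histogram P ≟ᵥ a′) * (weight Q * weightProduct P))
        ≡⟨ ∑-cong (allVecs objects m) (λ P →
             regroup (𝟙 1≤a[u₀]?) (𝟙 (histogram P ≟ᵥ a′)) (weight Q) (weightProduct P)) ⟩
      ∑[ P ← allVecs objects m ] (weight Q * (𝟙 1≤a[u₀]? * (𝟙 (histogram P ≟ᵥ a′) * weightProduct P)))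
        ≡⟨ *-distribˡ-∑ (allVecs objects m) (weight Q) _ ⟨
      weight Q * ∑[ P ← allVecs objects m ] (𝟙 1≤a[u₀]? * (𝟙 (histogram P ≟ᵥ a′) * weightProduct P))
        ≡⟨ cong (weight Q *_) (*-distribˡ-∑ (allVecs objects m) (𝟙 1≤a[u₀]?) _) ⟨
      weight Q * countMinus m a u₀
        ≡⟨ ∑-select-toℕ (type Q) typeQ<D (λ u → weight Q * countMinus m a u) ⟨
      ∑[ u ← allFin D ] (𝟙 (type Q ℕ.≟ toℕ u) * (weight Q * countMinus m a u)) ∎
      where
      open ≡-Reasoning
      u₀ : Fin D
      u₀ = fromℕ< typeQ<D
      typeQ≡u₀ : type Q ≡ toℕ u₀
      typeQ≡u₀ = sym (Finₚ.toℕ-fromℕ< typeQ<D)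
      a′ : Vec ℕ D
      a′ = updateAt a u₀ pred
      1≤a[u₀]? : Dec (1 ≤ lookup a u₀)
      1≤a[u₀]? = 1 ℕ.≤? lookup a u₀
      regroup : ∀ b h w p → b * h * (w * p) ≡ w * (b * (h * p))
      regroup = solve-∀
    ... | no typeQ≮D = trans
      (∑-zero (allVecs objects m) (λ P → cong (_* (weight Q * weightProduct P))
        (𝟙-no (histogram (Q ∷ P) ≟ᵥ a) (histogram≢ P))))
      (sym (∑-select-toℕ-≥ (type Q) typeQ≮D _))
      where
      histogram≢ : ∀ (P : Vec O m) → ¬ histogram (Q ∷ P) ≡ a
      histogram≢ P eq = ℕₚ.<-irrefl refl (ℕₚ.≤-trans (s≤s (∣histogram∣ᵥ≤ P))
        (ℕₚ.≤-reflexive (trans (sym ∣a∣≡1+m) (cong ∣_∣ᵥ (trans (sym eq) (histogram-∷-≥ Q P typeQ≮D))))))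

    count-suc : ∀ {m} (a : Vec ℕ D) → ∣ a ∣ᵥ ≡ suc m →
                count (suc m) a ≡ ∑[ u ← allFin D ] (typeWeight u * countMinus m a u)
    count-suc {m} a ∣a∣≡1+m = begin
      count (suc m) a
        ≡⟨ ∑-allVecs-suc objects m _ ⟩
      ∑[ Q ← objects ] ∑[ P ← allVecs objects m ] (𝟙 (histogram (Q ∷ P) ≟ᵥ a) * (weight Q * weightProduct P))
        ≡⟨ ∑-cong objects (count-∷ a ∣a∣≡1+m) ⟩
      ∑[ Q ← objects ] ∑[ u ← allFin D ] (𝟙 (type Q ℕ.≟ toℕ u) * (weight Q * countMinus m a u))
        ≡⟨ ∑-cong objects (λ Q → ∑-cong (allFin D) (λ u →
             sym (ℕₚ.*-assoc (𝟙 (type Q ℕ.≟ toℕ u)) _ _))) ⟩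
      ∑[ Q ← objects ] ∑[ u ← allFin D ] (𝟙 (type Q ℕ.≟ toℕ u) * weight Q * countMinus m a u)
        ≡⟨ ∑-comm objects (allFin D) _ ⟩
      ∑[ u ← allFin D ] ∑[ Q ← objects ] (𝟙 (type Q ℕ.≟ toℕ u) * weight Q * countMinus m a u)
        ≡⟨ ∑-cong (allFin D) (λ u → *-distribʳ-∑ objects (countMinus m a u) _) ⟨
      ∑[ u ← allFin D ] (typeWeight u * countMinus m a u) ∎
      where open ≡-Reasoning

    count-0*prodFact : (a : Vec ℕ D) → ∣ a ∣ᵥ ≡ 0 → count 0 a * prodFact a ≡ 0 ! * monomial a
    count-0*prodFact a ∣a∣≡0 = begin
      (𝟙 (histogram [] ≟ᵥ a) * 1 + 0) * prodFact a
        ≡⟨ cong₂ (λ x y → (x * 1 + 0) * y) (𝟙-yes (histogram [] ≟ᵥ a) histogram[]≡a)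
                                           (∣∣ᵥ≡0⇒prodFact≡1 a ∣a∣≡0) ⟩
      1
        ≡⟨ ∏-const-1# (allFin D) ⟨
      ∏[ u ← allFin D ] 1
        ≡⟨ ∏-cong (allFin D) (λ u → cong (typeWeight u ^_) (sym (∣∣ᵥ≡0⇒lookup≡0 a ∣a∣≡0 u))) ⟩
      monomial a
        ≡⟨ ℕₚ.+-identityʳ (monomial a) ⟨
      1 * monomial a ∎
      where
      open ≡-Reasoning
      histogram[]≡a : histogram [] ≡ a
      histogram[]≡a = lookup-ext λ t → trans (Vecₚ.lookup∘tabulate _ t) (sym (∣∣ᵥ≡0⇒lookup≡0 a ∣a∣≡0 t))

    count-step : ∀ {m} (a : Vec ℕ D) u → 1 ≤ lookup a u →
      count m (updateAt a u pred) * prodFact (updateAt a u pred) ≡ m ! * monomial (updateAt a u pred) →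
      typeWeight u * count m (updateAt a u pred) * prodFact a ≡ lookup a u * (m ! * monomial a)
    count-step {m} a u 1≤aᵤ count*prodFact[a′] = begin
      typeWeight u * count m a′ * prodFact a
        ≡⟨ cong (typeWeight u * count m a′ *_) (prodFact-updateAt-pred a u 1≤aᵤ) ⟨
      typeWeight u * count m a′ * (lookup a u * prodFact a′)
        ≡⟨ rearrange (typeWeight u) (count m a′) (lookup a u) (prodFact a′) ⟩
      lookup a u * (count m a′ * prodFact a′ * typeWeight u)
        ≡⟨ cong (λ x → lookup a u * (x * typeWeight u)) count*prodFact[a′] ⟩
      lookup a u * (m ! * monomial a′ * typeWeight u)
        ≡⟨ cong (lookup a u *_) (trans (ℕₚ.*-assoc (m !) _ _)
                                       (cong (m ! *_) (ℕₚ.*-comm (monomial a′) (typeWeight u)))) ⟩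
      lookup a u * (m ! * (typeWeight u * monomial a′))
        ≡⟨ cong (λ x → lookup a u * (m ! * x)) (∏^-updateAt-pred a u 1≤aᵤ typeWeight) ⟩
      lookup a u * (m ! * monomial a) ∎
      where
      open ≡-Reasoning
      a′ : Vec ℕ D
      a′ = updateAt a u pred
      rearrange : ∀ c x aᵤ p → c * x * (aᵤ * p) ≡ aᵤ * (x * p * c)
      rearrange = solve-∀

    count*prodFact : ∀ m (a : Vec ℕ D) → ∣ a ∣ᵥ ≡ m → count m a * prodFact a ≡ m ! * monomial a
    count*prodFact zero    a ∣a∣≡0   = count-0*prodFact a ∣a∣≡0
    count*prodFact (suc m) a ∣a∣≡1+m = begin
      count (suc m) a * prodFact a
        ≡⟨ cong (_* prodFact a) (count-suc a ∣a∣≡1+m) ⟩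
      ∑[ u ← allFin D ] (typeWeight u * countMinus m a u) * prodFact a
        ≡⟨ *-distribʳ-∑ (allFin D) (prodFact a) _ ⟩
      ∑[ u ← allFin D ] (typeWeight u * countMinus m a u * prodFact a)
        ≡⟨ ∑-cong (allFin D) (λ u → term u (1 ℕ.≤? lookup a u)) ⟩
      ∑[ u ← allFin D ] (lookup a u * (m ! * monomial a))
        ≡⟨ *-distribʳ-∑ (allFin D) (m ! * monomial a) (lookup a) ⟨
      ∑ (allFin D) (lookup a) * (m ! * monomial a)
        ≡⟨ cong (_* (m ! * monomial a)) (trans (sym (∣∣ᵥ≡∑ a)) ∣a∣≡1+m) ⟩
      suc m * (m ! * monomial a)
        ≡⟨ ℕₚ.*-assoc (suc m) (m !) (monomial a) ⟨
      suc m ! * monomial a ∎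
      where
      open ≡-Reasoning
      term : ∀ u (1≤aᵤ? : Dec (1 ≤ lookup a u)) →
             typeWeight u * (𝟙 1≤aᵤ? * count m (updateAt a u pred)) * prodFact a ≡ lookup a u * (m ! * monomial a)
      term u (yes 1≤aᵤ) = trans (cong (λ x → typeWeight u * x * prodFact a) (ℕₚ.*-identityˡ _))
        (count-step {m} a u 1≤aᵤ (count*prodFact m (updateAt a u pred)
          (ℕₚ.suc-injective (trans (∣updateAt-pred∣ᵥ a u 1≤aᵤ) ∣a∣≡1+m))))
      term u (no 1≰aᵤ) = begin
        typeWeight u * 0 * prodFact a   ≡⟨ cong (_* prodFact a) (ℕₚ.*-zeroʳ (typeWeight u)) ⟩
        0                               ≡⟨ cong (_* (m ! * monomial a)) (ℕₚ.n<1⇒n≡0 (ℕₚ.≰⇒> 1≰aᵤ)) ⟨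
        lookup a u * (m ! * monomial a) ∎

    count≡multinomial*monomial : ∀ m (a : Vec ℕ D) → ∣ a ∣ᵥ ≡ m → count m a ≡ multinomial m a * monomial a
    count≡multinomial*monomial m a ∣a∣≡m = ℕₚ.*-cancelʳ-≡ _ _ (prodFact a) ⦃ prodFact≢0 a ⦄ (begin
      count m a * prodFact a
        ≡⟨ count*prodFact m a ∣a∣≡m ⟩
      m ! * monomial a
        ≡⟨ cong (_* monomial a) (DivMod.m/n*n≡m ⦃ prodFact≢0 a ⦄ prodFact∣m!) ⟨
      multinomial m a * prodFact a * monomial a
        ≡⟨ ℕₚ.*-assoc (multinomial m a) _ _ ⟩
      multinomial m a * (prodFact a * monomial a)
        ≡⟨ cong (multinomial m a *_) (ℕₚ.*-comm (prodFact a) (monomial a)) ⟩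
      multinomial m a * (monomial a * prodFact a)
        ≡⟨ ℕₚ.*-assoc (multinomial m a) _ _ ⟨
      multinomial m a * monomial a * prodFact a ∎)
      where
      open ≡-Reasoning
      prodFact∣m! : prodFact a ∣ m !
      prodFact∣m! = subst (λ x → prodFact a ∣ x !) ∣a∣≡m (prodFact∣∣∣ᵥ! a)

open Multinomials

module Profiles where

  open import Algebra.Properties.CommutativeSemigroup ℕₚ.+-commutativeSemigroup using (interchange)
  open import Data.Empty using (⊥-elim)
  open import Data.Fin using (zero; suc; toℕ)
  open import Data.Fin.Subset using (Subset; ∁; ∣_∣)
  open import Data.List using (List; []; _∷_; allFin; length)
  import Data.List.Properties as Listₚ
  open import Data.List.Relation.Unary.All using ([]; _∷_)
  open import Data.Nat as ℕ using (ℕ; suc; _+_; _*_; _≤_; z≤n)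
  import Data.Nat.Properties as ℕₚ
  open import Data.Vec using (Vec; []; _∷_; lookup; tabulate; zipWith)
  import Data.Vec.Properties as Vecₚ
  open import Function using (_∘_)
  open import Relation.Binary.PropositionalEquality
  open import Relation.Nullary using (¬_; yes; no)

  open ℕΣ hiding (_+_; _*_)

  private variable n D : ℕ

  ∑-mono-≤ : ∀ {B : Set} (xs : List B) {f g : B → ℕ} → (∀ x → f x ≤ g x) → ∑ xs f ≤ ∑ xs g
  ∑-mono-≤ []       f≤g = z≤n
  ∑-mono-≤ (x ∷ xs) f≤g = ℕₚ.+-mono-≤ (f≤g x) (∑-mono-≤ xs f≤g)

  ∑-const-1 : ∀ {B : Set} (xs : List B) → ∑[ x ← xs ] 1 ≡ length xs
  ∑-const-1 []       = refl
  ∑-const-1 (x ∷ xs) = cong suc (∑-const-1 xs)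

  profile : ∀ d → Graph n → Vec ℕ (suc d)
  profile d G = tabulate λ t → numIndeg G (toℕ t)

  lookup-profile : ∀ d (G : Graph n) t → lookup (profile d G) t ≡ numIndeg G (toℕ t)
  lookup-profile d G t = Vecₚ.lookup∘tabulate (λ t → numIndeg G (toℕ t)) t

  profile≡⇒hasProfile : ∀ {d} {k : Vec ℕ (suc d)} (G : Graph n) → profile d G ≡ k → HasProfile k G
  profile≡⇒hasProfile {d = d} G refl t = sym (lookup-profile d G t)

  hasProfile⇒profile≡ : ∀ {d} {k : Vec ℕ (suc d)} (G : Graph n) → HasProfile k G → profile d G ≡ k
  hasProfile⇒profile≡ {d = d} G hasProfile = lookup-ext λ t → trans (lookup-profile d G t) (hasProfile t)

  ∣profile∣ᵥ≤ : ∀ d (G : Graph n) → ∣ profile d G ∣ᵥ ≤ n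
  ∣profile∣ᵥ≤ {n} d G = begin
    ∣ profile d G ∣ᵥ
      ≡⟨ ∣tabulate∣ᵥ {suc d} (λ t → numIndeg G (toℕ t)) ⟩
    ∑[ t ← allFin (suc d) ] numIndeg G (toℕ t)
      ≡⟨ ∑-cong (allFin (suc d)) (λ t → numIndeg≡∑ G (toℕ t)) ⟩
    ∑[ t ← allFin (suc d) ] ∑[ x ← allFin n ] 𝟙 (indeg G x ℕ.≟ toℕ t)
      ≡⟨ ∑-comm (allFin (suc d)) (allFin n) (λ t x → 𝟙 (indeg G x ℕ.≟ toℕ t)) ⟩
    ∑[ x ← allFin n ] ∑[ t ← allFin (suc d) ] 𝟙 (indeg G x ℕ.≟ toℕ t)
      ≤⟨ ∑-mono-≤ (allFin n) (λ x → ∑-𝟙-≟toℕ≤1 {suc d} (indeg G x)) ⟩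
    ∑[ x ← allFin n ] 1
      ≡⟨ ∑-const-1 (allFin n) ⟩
    length (allFin n)
      ≡⟨ Listₚ.length-tabulate _ ⟩
    n ∎
    where open ℕₚ.≤-Reasoning

  -- count H m a is the number of admissible choices of parent sets for m new sinks with indegree histogram a.
  module Attach (d : ℕ) {n′ : ℕ} (H : Graph n′) =
    WeightedMultinomial (allSubsets n′) ∣_∣ (𝟙 ∘ admissible? H) (suc d)

  module _ {d n′ : ℕ} (H : Graph n′) where
    open Attach d H using (weightProduct)

    weightProduct-admissible : ∀ {m} (P : Vec (Subset n′) m) →
      (∀ s → Admissible H (lookup P s)) → weightProduct P ≡ 1
    weightProduct-admissible []      _          = refl
    weightProduct-admissible (Q ∷ P) admissible =
      cong₂ _*_ (𝟙-yes (admissible? H Q) (admissible zero)) (weightProduct-admissible P (admissible ∘ suc))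

    weightProduct-inadmissible : ∀ {m} (P : Vec (Subset n′) m) →
      ¬ (∀ s → Admissible H (lookup P s)) → weightProduct P ≡ 0
    weightProduct-inadmissible []      ¬admissible = ⊥-elim (¬admissible (λ ()))
    weightProduct-inadmissible (Q ∷ P) ¬admissible with admissible? H Q
    ... | no _  = refl
    ... | yes Q-admissible = trans (ℕₚ.+-identityʳ _) (weightProduct-inadmissible P λ P-admissible →
      ¬admissible λ { zero → Q-admissible ; (suc s) → P-admissible s })

  module _ {d : ℕ} (S : Subset n) where
    open Adjoin S

    module _ (H : Graph ∣ ∁ S ∣) where
      open Attach d H using (histogram; lookup-histogram; typeCount; typeCount≡∑)

      profile-adjoin : (P : Vec (Subset ∣ ∁ S ∣) ∣ S ∣) →
                       profile d (adjoin H P) ≡ zipWith _+_ (histogram P) (profile d H)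
      profile-adjoin P = lookup-ext λ t → begin
        lookup (profile d (adjoin H P)) t
          ≡⟨ lookup-profile d (adjoin H P) t ⟩
        numIndeg (adjoin H P) (toℕ t)
          ≡⟨ numIndeg-adjoin S H P (toℕ t) ⟩
        ∑[ s ← allFin ∣ S ∣ ] 𝟙 (∣ lookup P s ∣ ℕ.≟ toℕ t) + numIndeg H (toℕ t)
          ≡⟨ cong₂ _+_ (sym (typeCount≡∑ t P)) (sym (lookup-profile d H t)) ⟩
        typeCount t P + lookup (profile d H) t
          ≡⟨ cong (_+ lookup (profile d H) t) (lookup-histogram P t) ⟨
        lookup (histogram P) t + lookup (profile d H) t
          ≡⟨ Vecₚ.lookup-zipWith _+_ t (histogram P) (profile d H) ⟨
        lookup (zipWith _+_ (histogram P) (profile d H)) t ∎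
        where open ≡-Reasoning

open Profiles

module Splits where

  open import Algebra.Properties.CommutativeSemigroup ℕₚ.+-commutativeSemigroup using (interchange)
  open import Data.Fin using (Fin; toℕ)
  import Data.Fin.Properties as Finₚ
  open import Data.Fin.Subset using (∣_∣)
  open import Data.List using ([]; _∷_; allFin; map)
  open import Data.List.Relation.Unary.All as All using (All; []; _∷_)
  open import Data.List.Relation.Unary.All.Properties using (concat⁺; map⁺; tabulate⁺)
  open import Data.Nat as ℕ using (ℕ; suc; _+_; _*_; _∸_; _≤_; s≤s)
  import Data.Nat.Properties as ℕₚ
  open import Data.Product using (_×_; _,_; proj₁; proj₂)
  open import Data.Vec using (Vec; []; _∷_; zipWith)
  import Data.Vec.Properties as Vecₚ
  open import Relation.Binary.PropositionalEquality
  open import Relation.Nullary using (_×-dec_)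

  open ℕΣ hiding (_+_; _*_)

  private variable D : ℕ

  ∣zipWith-+∣ᵥ : (a b : Vec ℕ D) → ∣ zipWith _+_ a b ∣ᵥ ≡ ∣ a ∣ᵥ + ∣ b ∣ᵥ
  ∣zipWith-+∣ᵥ []      []      = refl
  ∣zipWith-+∣ᵥ (x ∷ a) (y ∷ b) =
    trans (cong (x + y +_) (∣zipWith-+∣ᵥ a b)) (interchange x y ∣ a ∣ᵥ ∣ b ∣ᵥ)

  splits-sound : (k : Vec ℕ D) → All (λ p → zipWith _+_ (proj₁ p) (proj₂ p) ≡ k) (splits k)
  splits-sound []       = refl ∷ []
  splits-sound (x ∷ xs) = concat⁺ (map⁺ (tabulate⁺ {f = λ i → i} λ i →
    map⁺ (All.map (cong₂ _∷_ (ℕₚ.m+[n∸m]≡n (Finₚ.toℕ≤pred[n] i))) (splits-sound xs))))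

  splits-complete : (k a b : Vec ℕ D) → zipWith _+_ a b ≡ k →
    ∑[ p ← splits k ] (𝟙 (a ≟ᵥ proj₁ p) * 𝟙 (b ≟ᵥ proj₂ p)) ≡ 1
  splits-complete []       []       []       refl = refl
  splits-complete (x ∷ xs) (a₀ ∷ a) (b₀ ∷ b) eq = begin
    ∑ (splits (x ∷ xs)) matches₀
      ≡⟨ ∑-concatMap (allFin (suc x)) (λ i → map (extend i) (splits xs)) matches₀ ⟩
    ∑[ i ← allFin (suc x) ] ∑ (map (extend i) (splits xs)) matches₀
      ≡⟨ ∑-cong (allFin (suc x)) (λ i → ∑-map (splits xs) (extend i) matches₀) ⟩
    ∑[ i ← allFin (suc x) ] ∑[ p ← splits xs ] matches₀ (extend i p)
      ≡⟨ ∑-cong (allFin (suc x)) (λ i → ∑-cong (splits xs) (factor i)) ⟩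
    ∑[ i ← allFin (suc x) ] ∑[ p ← splits xs ] (𝟙 (a₀ ℕ.≟ toℕ i) * matches p)
      ≡⟨ ∑-cong (allFin (suc x)) (λ i → sym (*-distribˡ-∑ (splits xs) (𝟙 (a₀ ℕ.≟ toℕ i)) matches)) ⟩
    ∑[ i ← allFin (suc x) ] (𝟙 (a₀ ℕ.≟ toℕ i) * ∑ (splits xs) matches)
      ≡⟨ ∑-cong (allFin (suc x)) (λ i →
           cong (𝟙 (a₀ ℕ.≟ toℕ i) *_) (splits-complete xs a b (Vecₚ.∷-injectiveʳ eq))) ⟩
    ∑[ i ← allFin (suc x) ] (𝟙 (a₀ ℕ.≟ toℕ i) * 1)
      ≡⟨ ∑-select-toℕ a₀ (s≤s (subst (a₀ ≤_) (Vecₚ.∷-injectiveˡ eq) (ℕₚ.m≤m+n a₀ b₀))) (λ _ → 1) ⟩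
    1 ∎
    where
    open ≡-Reasoning
    matches₀ : Vec ℕ _ × Vec ℕ _ → ℕ
    matches₀ p = 𝟙 ((a₀ ∷ a) ≟ᵥ proj₁ p) * 𝟙 ((b₀ ∷ b) ≟ᵥ proj₂ p)
    matches : Vec ℕ _ × Vec ℕ _ → ℕ
    matches p = 𝟙 (a ≟ᵥ proj₁ p) * 𝟙 (b ≟ᵥ proj₂ p)
    extend : Fin (suc x) → Vec ℕ _ × Vec ℕ _ → Vec ℕ _ × Vec ℕ _
    extend i p = (toℕ i ∷ proj₁ p) , ((x ∸ toℕ i) ∷ proj₂ p)
    b₀≡x∸a₀ : b₀ ≡ x ∸ a₀
    b₀≡x∸a₀ = trans (sym (ℕₚ.m+n∸m≡n a₀ b₀)) (cong (_∸ a₀) (Vecₚ.∷-injectiveˡ eq))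
    factor : ∀ i p → matches₀ (extend i p) ≡ 𝟙 (a₀ ℕ.≟ toℕ i) * matches p
    factor i p = begin
      matches₀ (extend i p)
        ≡⟨ 𝟙-× ((a₀ ∷ a) ≟ᵥ (toℕ i ∷ proj₁ p)) ((b₀ ∷ b) ≟ᵥ ((x ∸ toℕ i) ∷ proj₂ p)) ⟨
      𝟙 ((a₀ ∷ a) ≟ᵥ (toℕ i ∷ proj₁ p) ×-dec (b₀ ∷ b) ≟ᵥ ((x ∸ toℕ i) ∷ proj₂ p))
        ≡⟨ 𝟙-⇔ _ ((a₀ ℕ.≟ toℕ i) ×-dec ((a ≟ᵥ proj₁ p) ×-dec (b ≟ᵥ proj₂ p)))
               (λ { (refl , refl) → refl , refl , refl })
               (λ { (refl , refl , refl) → refl , cong (_∷ b) b₀≡x∸a₀ }) ⟩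
      𝟙 ((a₀ ℕ.≟ toℕ i) ×-dec ((a ≟ᵥ proj₁ p) ×-dec (b ≟ᵥ proj₂ p)))
        ≡⟨ trans (𝟙-× (a₀ ℕ.≟ toℕ i) _) (cong (𝟙 (a₀ ℕ.≟ toℕ i) *_) (𝟙-× (a ≟ᵥ proj₁ p) (b ≟ᵥ proj₂ p))) ⟩
      𝟙 (a₀ ℕ.≟ toℕ i) * matches p ∎

open Splits

module InclusionExclusion where

  open import Data.Fin using (zero; suc; toℕ)
  import Data.Fin.Properties as Finₚ
  open import Data.Fin.Subset using (Subset; inside; outside; Nonempty; ∣_∣)
  open import Data.Fin.Subset.Properties using (_⊆?_; out⊆; in⊆in; drop-∷-⊆; ∣p∣≤n)
  open import Data.Integer using (ℤ; +_; _+_; _*_; _-_; 0ℤ; 1ℤ; -1ℤ; _^_)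
  import Data.Integer.Properties as ℤₚ
  open import Data.Integer.Tactic.RingSolver using (solve-∀)
  open import Data.List using (List; []; _∷_; allFin)
  open import Data.Nat as ℕ using (ℕ; zero; suc; s≤s)
  open import Data.Nat.Combinatorics using (_C_)
  import Data.Nat.Properties as ℕₚ
  open import Data.Product using (_,_)
  open import Data.Vec using ([]; _∷_; there)
  open import Function using (_∘_)
  open import Relation.Binary.PropositionalEquality
  open import Relation.Nullary using (Dec; yes; no)

  private variable n : ℕ

  open ℤΣ hiding (_+_; _*_)

  pos-∑ : ∀ {B : Set} (xs : List B) (f : B → ℕ) → + ℕΣ.∑ xs f ≡ ∑[ x ← xs ] (+ f x)
  pos-∑ []       f = refl
  pos-∑ (x ∷ xs) f = trans (ℤₚ.pos-+ (f x) _) (cong (_+_ (+ f x)) (pos-∑ xs f))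

  pos-∏ : ∀ {B : Set} (xs : List B) (f : B → ℕ) → + ℕΣ.∏ xs f ≡ ∏[ x ← xs ] (+ f x)
  pos-∏ []       f = refl
  pos-∏ (x ∷ xs) f = trans (ℤₚ.pos-* (f x) _) (cong (_*_ (+ f x)) (pos-∏ xs f))

  pos-𝟙 : ∀ {P : Set} (P? : Dec P) → + ℕΣ.𝟙 P? ≡ 𝟙 P?
  pos-𝟙 (yes _) = refl
  pos-𝟙 (no _)  = refl

  pos-∑-𝟙 : ∀ {B : Set} {P : B → Set} (P? : ∀ x → Dec (P x)) (xs : List B) →
            + ℕΣ.∑ xs (λ x → ℕΣ.𝟙 (P? x)) ≡ ∑[ x ← xs ] 𝟙 (P? x)
  pos-∑-𝟙 P? xs = trans (pos-∑ xs _) (∑-cong xs (λ x → pos-𝟙 (P? x)))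

  pos-𝟙* : ∀ {P : Set} (P? : Dec P) x → + (ℕΣ.𝟙 P? ℕ.* x) ≡ 𝟙 P? * + x
  pos-𝟙* P? x = trans (ℤₚ.pos-* (ℕΣ.𝟙 P?) x) (cong (_* + x) (pos-𝟙 P?))

  pos-^ : ∀ a e → + (a ℕ.^ e) ≡ (+ a) ^ e
  pos-^ a zero    = refl
  pos-^ a (suc e) = trans (ℤₚ.pos-* a (a ℕ.^ e)) (cong (_*_ (+ a)) (pos-^ a e))

  𝟙-outside∷⊆? : ∀ t (S T : Subset n) → 𝟙 (outside ∷ S ⊆? t ∷ T) ≡ 𝟙 (S ⊆? T)
  𝟙-outside∷⊆? t S T = 𝟙-⇔ (outside ∷ S ⊆? t ∷ T) (S ⊆? T) drop-∷-⊆ out⊆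

  𝟙-inside∷⊆?inside∷ : (S T : Subset n) → 𝟙 (inside ∷ S ⊆? inside ∷ T) ≡ 𝟙 (S ⊆? T)
  𝟙-inside∷⊆?inside∷ S T = 𝟙-⇔ (inside ∷ S ⊆? inside ∷ T) (S ⊆? T) drop-∷-⊆ in⊆in

  ∑-⊆-empty : (T : Subset n) → ∑[ S ← allSubsets n ] (𝟙 (S ⊆? T) * 𝟙 (∣ S ∣ ℕ.≟ 0)) ≡ 1ℤ
  ∑-⊆-empty []      = refl
  ∑-⊆-empty {suc n} (t ∷ T) = begin
    ∑[ S ← allSubsets (suc n) ] (𝟙 (S ⊆? t ∷ T) * 𝟙 (∣ S ∣ ℕ.≟ 0))
      ≡⟨ ∑-allSubsets-suc n _ ⟩
    ∑[ S ← allSubsets n ] (𝟙 (inside ∷ S ⊆? t ∷ T) * 0ℤ)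
      + ∑[ S ← allSubsets n ] (𝟙 (outside ∷ S ⊆? t ∷ T) * 𝟙 (∣ S ∣ ℕ.≟ 0))
      ≡⟨ cong₂ _+_ (∑-zero (allSubsets n) (λ S → ℤₚ.*-zeroʳ (𝟙 (inside ∷ S ⊆? t ∷ T))))
                   (∑-cong (allSubsets n) (λ S → cong (_* 𝟙 (∣ S ∣ ℕ.≟ 0)) (𝟙-outside∷⊆? t S T))) ⟩
    0ℤ + ∑[ S ← allSubsets n ] (𝟙 (S ⊆? T) * 𝟙 (∣ S ∣ ℕ.≟ 0))
      ≡⟨ trans (ℤₚ.+-identityˡ _) (∑-⊆-empty T) ⟩
    1ℤ ∎
    where open ≡-Reasoning

  ∑-⊆-sign : (T : Subset n) → Nonempty T → ∑[ S ← allSubsets n ] (𝟙 (S ⊆? T) * signℤ ∣ S ∣) ≡ 0ℤ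
  ∑-⊆-sign {suc n} (inside ∷ T) _ = begin
    ∑[ S ← allSubsets (suc n) ] (𝟙 (S ⊆? inside ∷ T) * signℤ ∣ S ∣)
      ≡⟨ ∑-allSubsets-suc n _ ⟩
    ∑[ S ← allSubsets n ] (𝟙 (inside ∷ S ⊆? inside ∷ T) * signℤ (suc ∣ S ∣))
      + ∑[ S ← allSubsets n ] (𝟙 (outside ∷ S ⊆? inside ∷ T) * signℤ ∣ S ∣)
      ≡⟨ cong₂ _+_ (∑-cong (allSubsets n) (λ S → cong (_* signℤ (suc ∣ S ∣)) (𝟙-inside∷⊆?inside∷ S T)))
                   (∑-cong (allSubsets n) (λ S → cong (_* signℤ ∣ S ∣) (𝟙-outside∷⊆? inside S T))) ⟩
    ∑[ S ← allSubsets n ] (𝟙 (S ⊆? T) * (-1ℤ * signℤ ∣ S ∣))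
      + ∑[ S ← allSubsets n ] (𝟙 (S ⊆? T) * signℤ ∣ S ∣)
      ≡⟨ ∑-distrib-+ (allSubsets n) _ _ ⟨
    ∑[ S ← allSubsets n ] (𝟙 (S ⊆? T) * (-1ℤ * signℤ ∣ S ∣) + 𝟙 (S ⊆? T) * signℤ ∣ S ∣)
      ≡⟨ ∑-zero (allSubsets n) (λ S → cancel (𝟙 (S ⊆? T)) (signℤ ∣ S ∣)) ⟩
    0ℤ ∎
    where
    open ≡-Reasoning
    cancel : ∀ a s → a * (-1ℤ * s) + a * s ≡ 0ℤ
    cancel = solve-∀
  ∑-⊆-sign {suc n} (outside ∷ T) (suc x , there x∈T) = begin
    ∑[ S ← allSubsets (suc n) ] (𝟙 (S ⊆? outside ∷ T) * signℤ ∣ S ∣)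
      ≡⟨ ∑-allSubsets-suc n _ ⟩
    ∑[ S ← allSubsets n ] (𝟙 (inside ∷ S ⊆? outside ∷ T) * signℤ (suc ∣ S ∣))
      + ∑[ S ← allSubsets n ] (𝟙 (outside ∷ S ⊆? outside ∷ T) * signℤ ∣ S ∣)
      ≡⟨ cong₂ _+_ (∑-zero (allSubsets n) (λ S → refl))
                   (∑-cong (allSubsets n) (λ S → cong (_* signℤ ∣ S ∣) (𝟙-outside∷⊆? outside S T))) ⟩
    0ℤ + ∑[ S ← allSubsets n ] (𝟙 (S ⊆? T) * signℤ ∣ S ∣)
      ≡⟨ trans (ℤₚ.+-identityˡ _) (∑-⊆-sign T (x , x∈T)) ⟩
    0ℤ ∎
    where open ≡-Reasoning

  ieWeight : ℕ → ℤ
  ieWeight zero    = 0ℤ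
  ieWeight (suc j) = signℤ (suc j ℕ.+ 1)

  ieWeight≡𝟙-sign : ∀ j → ieWeight j ≡ 𝟙 (j ℕ.≟ 0) - signℤ j
  ieWeight≡𝟙-sign zero    = refl
  ieWeight≡𝟙-sign (suc j) = trans (cong signℤ (cong suc (ℕₚ.+-comm j 1))) (flip (signℤ (suc j)))
    where
    flip : ∀ s → -1ℤ * s ≡ 0ℤ - s
    flip = solve-∀

  ∑-⊆-ieWeight : (T : Subset n) → Nonempty T →
                 ∑[ S ← allSubsets n ] (𝟙 (S ⊆? T) * ieWeight ∣ S ∣) ≡ 1ℤ
  ∑-⊆-ieWeight {n} T nonempty = begin
    ∑[ S ← allSubsets n ] (𝟙 (S ⊆? T) * ieWeight ∣ S ∣)
      ≡⟨ ∑-cong (allSubsets n) (λ S →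
           trans (cong (𝟙 (S ⊆? T) *_) (ieWeight≡𝟙-sign ∣ S ∣)) (distribute (𝟙 (S ⊆? T)) _ _)) ⟩
    ∑[ S ← allSubsets n ] (𝟙 (S ⊆? T) * 𝟙 (∣ S ∣ ℕ.≟ 0) + -1ℤ * (𝟙 (S ⊆? T) * signℤ ∣ S ∣))
      ≡⟨ ∑-distrib-+ (allSubsets n) _ _ ⟩
    ∑[ S ← allSubsets n ] (𝟙 (S ⊆? T) * 𝟙 (∣ S ∣ ℕ.≟ 0))
      + ∑[ S ← allSubsets n ] (-1ℤ * (𝟙 (S ⊆? T) * signℤ ∣ S ∣))
      ≡⟨ cong₂ _+_ (∑-⊆-empty T)
                   (trans (sym (*-distribˡ-∑ (allSubsets n) -1ℤ _)) (cong (-1ℤ *_) (∑-⊆-sign T nonempty))) ⟩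
    1ℤ + -1ℤ * 0ℤ
      ≡⟨⟩
    1ℤ ∎
    where
    open ≡-Reasoning
    distribute : ∀ a e s → a * (e - s) ≡ a * e + -1ℤ * (a * s)
    distribute = solve-∀

  ∑-allSubsets-by-size : ∀ n (φ : ℕ → ℤ) →
    ∑[ S ← allSubsets n ] φ ∣ S ∣ ≡ ∑[ j ← allFin (suc n) ] (+ (n C toℕ j) * φ (toℕ j))
  ∑-allSubsets-by-size n φ = begin
    ∑[ S ← allSubsets n ] φ ∣ S ∣
      ≡⟨ ∑-cong (allSubsets n) (λ S → trans (cong φ (sym (Finₚ.toℕ-fromℕ< (s≤s (∣p∣≤n S)))))
                                            (sym (∑-select-toℕ ∣ S ∣ (s≤s (∣p∣≤n S)) (φ ∘ toℕ)))) ⟩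
    ∑[ S ← allSubsets n ] ∑[ j ← allFin (suc n) ] (𝟙 (∣ S ∣ ℕ.≟ toℕ j) * φ (toℕ j))
      ≡⟨ ∑-comm (allSubsets n) (allFin (suc n)) _ ⟩
    ∑[ j ← allFin (suc n) ] ∑[ S ← allSubsets n ] (𝟙 (∣ S ∣ ℕ.≟ toℕ j) * φ (toℕ j))
      ≡⟨ ∑-cong (allFin (suc n)) (λ j → sym (*-distribʳ-∑ (allSubsets n) (φ (toℕ j)) _)) ⟩
    ∑[ j ← allFin (suc n) ] (∑[ S ← allSubsets n ] 𝟙 (∣ S ∣ ℕ.≟ toℕ j) * φ (toℕ j))
      ≡⟨ ∑-cong (allFin (suc n)) (λ j → cong (_* φ (toℕ j)) (begin
           ∑[ S ← allSubsets n ] 𝟙 (∣ S ∣ ℕ.≟ toℕ j)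
             ≡⟨ ∑-cong (allSubsets n) (λ S → pos-𝟙 (∣ S ∣ ℕ.≟ toℕ j)) ⟨
           ∑[ S ← allSubsets n ] (+ ℕΣ.𝟙 (∣ S ∣ ℕ.≟ toℕ j))
             ≡⟨ pos-∑ (allSubsets n) _ ⟨
           + ℕΣ.∑ (allSubsets n) (λ S → ℕΣ.𝟙 (∣ S ∣ ℕ.≟ toℕ j))
             ≡⟨ cong +_ (subsets-of-size≡C n (toℕ j)) ⟩
           + (n C toℕ j) ∎)) ⟩
    ∑[ j ← allFin (suc n) ] (+ (n C toℕ j) * φ (toℕ j)) ∎
    where
    open ≡-Reasoning

  ∑-ieWeight-by-size : ∀ n (f : ℕ → ℤ) →
    ∑[ S ← allSubsets n ] (ieWeight ∣ S ∣ * f ∣ S ∣)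
    ≡ ∑[ i ← allFin n ] (signℤ (suc (toℕ i) ℕ.+ 1) * + (n C suc (toℕ i)) * f (suc (toℕ i)))
  ∑-ieWeight-by-size n f = begin
    ∑[ S ← allSubsets n ] (ieWeight ∣ S ∣ * f ∣ S ∣)
      ≡⟨ ∑-allSubsets-by-size n (λ j → ieWeight j * f j) ⟩
    ∑[ j ← allFin (suc n) ] (+ (n C toℕ j) * (ieWeight (toℕ j) * f (toℕ j)))
      ≡⟨ ∑-allFin-suc n (λ j → + (n C toℕ j) * (ieWeight (toℕ j) * f (toℕ j))) ⟩
    + (n C 0) * (0ℤ * f 0) + ∑[ i ← allFin n ] (+ (n C suc (toℕ i)) * (ieWeight (suc (toℕ i)) * f (suc (toℕ i))))
      ≡⟨ cong (_+ ∑[ i ← allFin n ] (+ (n C suc (toℕ i)) * (ieWeight (suc (toℕ i)) * f (suc (toℕ i)))))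
              (ℤₚ.*-zeroʳ (+ (n C 0))) ⟩
    0ℤ + ∑[ i ← allFin n ] (+ (n C suc (toℕ i)) * (ieWeight (suc (toℕ i)) * f (suc (toℕ i))))
      ≡⟨ ℤₚ.+-identityˡ _ ⟩
    ∑[ i ← allFin n ] (+ (n C suc (toℕ i)) * (ieWeight (suc (toℕ i)) * f (suc (toℕ i))))
      ≡⟨ ∑-cong (allFin n) (λ i → reorder (+ (n C suc (toℕ i))) (ieWeight (suc (toℕ i))) (f (suc (toℕ i)))) ⟩
    ∑[ i ← allFin n ] (signℤ (suc (toℕ i) ℕ.+ 1) * + (n C suc (toℕ i)) * f (suc (toℕ i))) ∎
    where
    open ≡-Reasoning
    reorder : ∀ c w x → c * (w * x) ≡ w * c * x
    reorder = solve-∀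

open InclusionExclusion

module Recursion where

  open import Data.Empty using (⊥-elim)
  open import Data.Fin as Fin using (Fin; zero; suc; toℕ; inject₁)
  import Data.Fin.Properties as Finₚ
  open import Data.Fin.Subset using (Subset; ∁; ∣_∣)
  open import Data.Fin.Subset.Properties using (_⊆?_; ∣∁p∣≡n∸∣p∣)
  open import Data.Integer as ℤ using (ℤ; +_; 1ℤ)
  import Data.Integer.Properties as ℤₚ
  open import Data.Integer.Tactic.RingSolver using (solve-∀)
  open import Data.List using (List; allFin; filter)
  open import Data.Nat as ℕ using (ℕ; zero; suc; _∸_; _≤_)
  open import Data.Nat.Combinatorics using (_C_)
  import Data.Nat.Properties as ℕₚ
  open import Data.Product using (_×_; _,_; proj₁; proj₂; uncurry)
  open import Data.Vec using (Vec; lookup; zipWith)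
  import Data.Vec.Properties as Vecₚ
  open import Function using (_∘_)
  open import Relation.Binary.PropositionalEquality
  open import Relation.Nullary using (Dec; yes; no; map′)

  EssProfileDecider : ℕ → Set
  EssProfileDecider d = (k : Vec ℕ (suc d)) (G : Graph ∣ k ∣ᵥ) → Dec (EssProfile k G)

  -- the number of ways to attach m new sinks with indegree histogram a to an essential DAG on n ∸ m
  -- nodes with profile b
  attachments : ∀ {d} → ℕ → ℕ → Vec ℕ (suc d) → Vec ℕ (suc d) → ℤ
  attachments {d} n m a b = + multinomial m a ℤ.* ℤΣ.∏ (allFin (suc d))
    (λ t → (+ ((n ∸ m) C toℕ t) ℤ.- + prevEntry b t) ℤ.^ lookup a t)

  innerSum : ∀ {d} → EssProfileDecider d → Vec ℕ (suc d) → ℕ → ℤ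
  innerSum dec k m = ℤΣ.∑ (filter (λ p → ∣ proj₁ p ∣ᵥ ℕ.≟ m) (splits k))
    (λ p → attachments ∣ k ∣ᵥ m (proj₁ p) (proj₂ p) ℤ.* + aCount dec (proj₂ p))

  module _ where
    open ℕΣ hiding (_+_; _*_)

    _≟ᵍ_ : ∀ {n} (G H : Graph n) → Dec (G ≡ H)
    _≟ᵍ_ = Vecₚ.≡-dec _≟ˢ_

    allGraphs-isEnumeration : ∀ n → IsEnumeration _≟ᵍ_ (allGraphs n)
    allGraphs-isEnumeration n = allVecs-isEnumeration (allSubsets-isEnumeration n) n

    ∑-⊆-sinks : ∀ {n} (S : Subset n) (f : Graph n → ℕ) →
      ∑[ G ← allGraphs n ] (𝟙 (S ⊆? sinks G) ℕ.* f G)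
      ≡ ∑[ H ← allGraphs ∣ ∁ S ∣ ] ∑[ P ← allVecs (allSubsets ∣ ∁ S ∣) ∣ S ∣ ]
          f (Adjoin.adjoin S H P)
    ∑-⊆-sinks {n} S f = trans
      (∑-bijection (allGraphs-isEnumeration n)
        (pairs-isEnumeration (allGraphs-isEnumeration _) (allVecs-isEnumeration (allSubsets-isEnumeration _) _))
        (λ G → S ⊆? sinks G) (uncurry adjoin) (λ G → core G , sinkParents G)
        (λ (H , P) → sinksAt⇒⊆-sinks S {adjoin H P} (adjoin-sinksAt H P))
        (λ (H , P) → cong₂ _,_ (core-adjoin H P) (sinkParents-adjoin H P))
        (λ G S⊆sinks → adjoin-core G (⊆-sinks⇒sinksAt S {G} S⊆sinks)) f)
      (∑-pairs (allGraphs _) _ (f ∘ uncurry adjoin))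
      where open Adjoin S

    module _ {d : ℕ} (dec : EssProfileDecider d) where

      -- dec only decides EssProfile for graphs with exactly |b| nodes
      essProfile? : (b : Vec ℕ (suc d)) {N : ℕ} (H : Graph N) →
                    Dec (∣ b ∣ᵥ ≡ N × EssentialDAG H × HasProfile b H)
      essProfile? b {N} H with ∣ b ∣ᵥ ℕ.≟ N
      ... | no ∣b∣≢N = no (∣b∣≢N ∘ proj₁)
      ... | yes refl = map′ (refl ,_) proj₂ (dec b H)

      ∑-essProfile? : (b : Vec ℕ (suc d)) {N : ℕ} → ∣ b ∣ᵥ ≡ N →
                      ∑[ H ← allGraphs N ] 𝟙 (essProfile? b H) ≡ aCount dec b
      ∑-essProfile? b refl = trans
        (∑-cong (allGraphs _) (λ H → 𝟙-⇔ (essProfile? b H) (dec b H) proj₂ (refl ,_)))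
        (sym (length-filter≡∑ (dec b) (allGraphs _)))

    module _ {d : ℕ} (dec : EssProfileDecider d) (k : Vec ℕ (suc d)) (S : Subset ∣ k ∣ᵥ) where
      open Adjoin S

      private
        m n′ : ℕ
        m  = ∣ S ∣
        n′ = ∣ ∁ S ∣

      open Attach d using (histogram; weightProduct; count; ∣histogram∣ᵥ≤)

      contribution : Graph n′ → Vec (Subset n′) m → Vec ℕ (suc d) × Vec ℕ (suc d) → ℕ
      contribution H P (a , b) = 𝟙 (essProfile? dec b H) ℕ.* (𝟙 (histogram H P ≟ᵥ a) ℕ.* weightProduct H P)

      -- |histogram P| ≤ m and |profile H| ≤ n′ add up to |k| = m + n′
      ∣profile∣ᵥ≡n′ : ∀ H (P : Vec (Subset n′) m) →
                      zipWith ℕ._+_ (histogram H P) (profile d H) ≡ k → ∣ profile d H ∣ᵥ ≡ n′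
      ∣profile∣ᵥ≡n′ H P sum≡k = ℕₚ.≤-antisym (∣profile∣ᵥ≤ d H) (ℕₚ.+-cancelˡ-≤ m _ _ (begin
        m ℕ.+ n′
          ≡⟨ ∣S∣+∣∁S∣≡n S ⟩
        ∣ k ∣ᵥ
          ≡⟨ cong ∣_∣ᵥ sum≡k ⟨
        ∣ zipWith ℕ._+_ (histogram H P) (profile d H) ∣ᵥ
          ≡⟨ ∣zipWith-+∣ᵥ (histogram H P) (profile d H) ⟩
        ∣ histogram H P ∣ᵥ ℕ.+ ∣ profile d H ∣ᵥ
          ≤⟨ ℕₚ.+-monoˡ-≤ _ (∣histogram∣ᵥ≤ H P) ⟩
        m ℕ.+ ∣ profile d H ∣ᵥ ∎))
        where open ℕₚ.≤-Reasoning

      𝟙-essProfile-adjoin : ∀ H P → 𝟙 (dec k (adjoin H P)) ≡ ∑[ p ← splits k ] contribution H P p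
      𝟙-essProfile-adjoin H P with dec k (adjoin H P)
      ... | yes (essential , hasProfile) =
        sym (trans (∑-cong (splits k) term) (splits-complete k (histogram H P) (profile d H) sum≡k))
        where
        sum≡k : zipWith ℕ._+_ (histogram H P) (profile d H) ≡ k
        sum≡k = trans (sym (profile-adjoin S H P)) (hasProfile⇒profile≡ (adjoin H P) hasProfile)
        essentialH : EssentialDAG H
        essentialH = proj₁ (essential-adjoin⁻ H P essential)
        term : ∀ p → contribution H P p ≡ 𝟙 (histogram H P ≟ᵥ proj₁ p) ℕ.* 𝟙 (profile d H ≟ᵥ proj₂ p)
        term (a , b) = begin
          𝟙 (essProfile? dec b H) ℕ.* (𝟙 (histogram H P ≟ᵥ a) ℕ.* weightProduct H P)
            ≡⟨ cong (λ w → 𝟙 (essProfile? dec b H) ℕ.* (𝟙 (histogram H P ≟ᵥ a) ℕ.* w))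
                    (weightProduct-admissible {d = d} H P (proj₂ (essential-adjoin⁻ H P essential))) ⟩
          𝟙 (essProfile? dec b H) ℕ.* (𝟙 (histogram H P ≟ᵥ a) ℕ.* 1)
            ≡⟨ cong (𝟙 (essProfile? dec b H) ℕ.*_) (ℕₚ.*-identityʳ _) ⟩
          𝟙 (essProfile? dec b H) ℕ.* 𝟙 (histogram H P ≟ᵥ a)
            ≡⟨ ℕₚ.*-comm (𝟙 (essProfile? dec b H)) _ ⟩
          𝟙 (histogram H P ≟ᵥ a) ℕ.* 𝟙 (essProfile? dec b H)
            ≡⟨ cong (𝟙 (histogram H P ≟ᵥ a) ℕ.*_) (𝟙-⇔ (essProfile? dec b H) (profile d H ≟ᵥ b)
                 (λ (_ , _ , hasProfile) → hasProfile⇒profile≡ H hasProfile)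
                 (λ { refl → ∣profile∣ᵥ≡n′ H P sum≡k , essentialH , profile≡⇒hasProfile {d = d} H refl })) ⟩
          𝟙 (histogram H P ≟ᵥ a) ℕ.* 𝟙 (profile d H ≟ᵥ b) ∎
          where open ≡-Reasoning
      ... | no ¬essProfile =
        sym (trans (∑-congᴬ (splits-sound k) (λ (a , b) → term a b)) (∑-zero (splits k) (λ _ → refl)))
        where
        term : ∀ a b → zipWith ℕ._+_ a b ≡ k → contribution H P (a , b) ≡ 0
        term a b sum≡k with essProfile? dec b H | histogram H P ≟ᵥ a
        ... | no _ | _ = refl
        ... | yes _ | no _ = refl
        ... | yes (_ , essentialH , hasProfile) | yes refl with Finₚ.all? (λ s → admissible? H (lookup P s))
        ...   | no ¬admissible = trans (ℕₚ.+-identityʳ _)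
          (trans (ℕₚ.+-identityʳ _) (weightProduct-inadmissible {d = d} H P ¬admissible))
        ...   | yes admissible = ⊥-elim (¬essProfile (essential-adjoin⁺ H P essentialH admissible ,
          profile≡⇒hasProfile (adjoin H P) (trans (profile-adjoin S H P)
            (trans (cong (zipWith ℕ._+_ (histogram H P)) (hasProfile⇒profile≡ H hasProfile)) sum≡k))))

      countWithSinks : ℕ
      countWithSinks = ∑[ G ← allGraphs ∣ k ∣ᵥ ] (𝟙 (S ⊆? sinks G) ℕ.* 𝟙 (dec k G))

      splitCount : Vec ℕ (suc d) × Vec ℕ (suc d) → ℕ
      splitCount (a , b) = ∑[ H ← allGraphs n′ ] (𝟙 (essProfile? dec b H) ℕ.* count H m a)

      countWithSinks≡∑-splits : countWithSinks ≡ ∑[ p ← splits k ] splitCount p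
      countWithSinks≡∑-splits = begin
        countWithSinks
          ≡⟨ ∑-⊆-sinks S (𝟙 ∘ dec k) ⟩
        ∑[ H ← allGraphs n′ ] ∑[ P ← parentSets ] 𝟙 (dec k (adjoin H P))
          ≡⟨ ∑-cong (allGraphs n′) (λ H → ∑-cong parentSets (𝟙-essProfile-adjoin H)) ⟩
        ∑[ H ← allGraphs n′ ] ∑[ P ← parentSets ] ∑[ p ← splits k ] contribution H P p
          ≡⟨ ∑-cong (allGraphs n′) (λ H → ∑-comm parentSets (splits k) (contribution H)) ⟩
        ∑[ H ← allGraphs n′ ] ∑[ p ← splits k ] ∑[ P ← parentSets ] contribution H P p
          ≡⟨ ∑-cong (allGraphs n′) (λ H → ∑-cong (splits k) (λ (a , b) → *-distribˡ-∑ parentSets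
               (𝟙 (essProfile? dec b H)) (λ P → 𝟙 (histogram H P ≟ᵥ a) ℕ.* weightProduct H P))) ⟨
        ∑[ H ← allGraphs n′ ] ∑[ p ← splits k ] (𝟙 (essProfile? dec (proj₂ p) H) ℕ.* count H m (proj₁ p))
          ≡⟨ ∑-comm (allGraphs n′) (splits k) _ ⟩
        ∑[ p ← splits k ] splitCount p ∎
        where
        open ≡-Reasoning
        parentSets : List (Vec (Subset n′) m)
        parentSets = allVecs (allSubsets n′) m

  module _ where
    open ℤΣ hiding (_+_; _*_)

    previousCount≡prevEntry : ∀ {d N} (H : Graph N) (acyclic : Acyclic H) {b : Vec ℕ (suc d)} → HasProfile b H →
      ∀ u → AdmissibleCount.previousCount H acyclic (toℕ u) ≡ prevEntry b u
    previousCount≡prevEntry H acyclic hasProfile zero    = refl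
    previousCount≡prevEntry H acyclic hasProfile (suc t) =
      trans (cong (numIndeg H) (sym (Finₚ.toℕ-inject₁ t))) (hasProfile (inject₁ t))

    module _ {d : ℕ} (dec : EssProfileDecider d) (k : Vec ℕ (suc d)) (S : Subset ∣ k ∣ᵥ) where

      private
        m n′ : ℕ
        m  = ∣ S ∣
        n′ = ∣ ∁ S ∣

      open Attach d using (count; monomial; typeWeight; count≡multinomial*monomial)

      pos-typeWeight : ∀ H (acyclic : Acyclic H) {b} → HasProfile b H →
        ∀ t → + typeWeight H t ≡ + ((∣ k ∣ᵥ ∸ m) C toℕ t) ℤ.- + prevEntry b t
      pos-typeWeight H acyclic {b} hasProfile t = begin
        + typeWeight H t
          ≡⟨ cancel (typeWeight H t) (previousCount (toℕ t)) ⟩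
        + (typeWeight H t ℕ.+ previousCount (toℕ t)) ℤ.- + previousCount (toℕ t)
          ≡⟨ cong₂ (λ c p → + c ℤ.- + p) (admissibleCount+previousCount (toℕ t))
                                         (previousCount≡prevEntry H acyclic hasProfile t) ⟩
        + (n′ C toℕ t) ℤ.- + prevEntry b t
          ≡⟨ cong (λ x → + (x C toℕ t) ℤ.- + prevEntry b t) (∣∁p∣≡n∸∣p∣ S) ⟩
        + ((∣ k ∣ᵥ ∸ m) C toℕ t) ℤ.- + prevEntry b t ∎
        where
        open ≡-Reasoning
        open AdmissibleCount H acyclic using (previousCount; admissibleCount+previousCount)
        x≡x+p-p : ∀ x p → x ≡ x ℤ.+ p ℤ.- p
        x≡x+p-p = solve-∀
        cancel : ∀ x p → + x ≡ + (x ℕ.+ p) ℤ.- + p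
        cancel x p = trans (x≡x+p-p (+ x) (+ p)) (cong (ℤ._- + p) (sym (ℤₚ.pos-+ x p)))

      pos-count≡attachments : ∀ H {a b} → Acyclic H → HasProfile b H → ∣ a ∣ᵥ ≡ m →
                              + count H m a ≡ attachments ∣ k ∣ᵥ m a b
      pos-count≡attachments H {a} {b} acyclic hasProfile ∣a∣≡m = begin
        + count H m a
          ≡⟨ cong +_ (count≡multinomial*monomial H m a ∣a∣≡m) ⟩
        + (multinomial m a ℕ.* monomial H a)
          ≡⟨ ℤₚ.pos-* (multinomial m a) (monomial H a) ⟩
        + multinomial m a ℤ.* + monomial H a
          ≡⟨ cong (+ multinomial m a ℤ.*_) (pos-∏ (allFin (suc d)) _) ⟩
        + multinomial m a ℤ.* ∏[ t ← allFin (suc d) ] (+ (typeWeight H t ℕ.^ lookup a t))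
          ≡⟨ cong (+ multinomial m a ℤ.*_) (∏-cong (allFin (suc d)) λ t →
               trans (pos-^ (typeWeight H t) (lookup a t)) (cong (ℤ._^ lookup a t) (pos-typeWeight H acyclic hasProfile t))) ⟩
        attachments ∣ k ∣ᵥ m a b ∎
        where open ≡-Reasoning

      ∣a∣+∣b∣≡m+n′ : ∀ {a b} → zipWith ℕ._+_ a b ≡ k → ∣ a ∣ᵥ ℕ.+ ∣ b ∣ᵥ ≡ m ℕ.+ n′
      ∣a∣+∣b∣≡m+n′ {a} {b} a+b≡k =
        trans (sym (∣zipWith-+∣ᵥ a b)) (trans (cong ∣_∣ᵥ a+b≡k) (sym (∣S∣+∣∁S∣≡n S)))

      pos-splitCount : ∀ a b → zipWith ℕ._+_ a b ≡ k →
        + splitCount dec k S (a , b) ≡ 𝟙 (∣ a ∣ᵥ ℕ.≟ m) ℤ.* (attachments ∣ k ∣ᵥ m a b ℤ.* + aCount dec b)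
      pos-splitCount a b a+b≡k with ∣ a ∣ᵥ ℕ.≟ m
      ... | yes ∣a∣≡m = begin
        + splitCount dec k S (a , b)
          ≡⟨ pos-∑ (allGraphs n′) _ ⟩
        ∑[ H ← allGraphs n′ ] (+ (ℕΣ.𝟙 (essProfile? dec b H) ℕ.* count H m a))
          ≡⟨ ∑-cong (allGraphs n′) (λ H → pos-𝟙* (essProfile? dec b H) (count H m a)) ⟩
        ∑[ H ← allGraphs n′ ] (𝟙 (essProfile? dec b H) ℤ.* + count H m a)
          ≡⟨ ∑-cong (allGraphs n′) (λ H → 𝟙-*-cong (essProfile? dec b H)
               (λ (_ , (acyclic , _) , hasProfile) → pos-count≡attachments H {a} {b} acyclic hasProfile ∣a∣≡m)) ⟩
        ∑[ H ← allGraphs n′ ] (𝟙 (essProfile? dec b H) ℤ.* attachments ∣ k ∣ᵥ m a b)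
          ≡⟨ *-distribʳ-∑ (allGraphs n′) (attachments ∣ k ∣ᵥ m a b) _ ⟨
        ∑[ H ← allGraphs n′ ] 𝟙 (essProfile? dec b H) ℤ.* attachments ∣ k ∣ᵥ m a b
          ≡⟨ cong (ℤ._* attachments ∣ k ∣ᵥ m a b)
             (trans (sym (pos-∑-𝟙 (essProfile? dec b) (allGraphs n′)))
                    (cong +_ (∑-essProfile? dec b ∣b∣≡n′))) ⟩
        + aCount dec b ℤ.* attachments ∣ k ∣ᵥ m a b
          ≡⟨ swap (+ aCount dec b) (attachments ∣ k ∣ᵥ m a b) ⟩
        1ℤ ℤ.* (attachments ∣ k ∣ᵥ m a b ℤ.* + aCount dec b) ∎
        where
        open ≡-Reasoning
        swap : ∀ x y → x ℤ.* y ≡ 1ℤ ℤ.* (y ℤ.* x)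
        swap = solve-∀
        ∣b∣≡n′ : ∣ b ∣ᵥ ≡ n′
        ∣b∣≡n′ = ℕₚ.+-cancelˡ-≡ m _ _
          (trans (cong (ℕ._+ ∣ b ∣ᵥ) (sym ∣a∣≡m)) (∣a∣+∣b∣≡m+n′ a+b≡k))
      ... | no ∣a∣≢m = trans
        (cong +_ (ℕΣ.∑-zero (allGraphs n′) (λ H →
          cong (ℕ._* count H m a) (ℕΣ.𝟙-no (essProfile? dec b H) (∣a∣≢m ∘ ∣a∣≡m ∘ proj₁)))))
        (sym (ℤₚ.*-zeroˡ (attachments ∣ k ∣ᵥ m a b ℤ.* + aCount dec b)))
        where
        ∣a∣≡m : ∣ b ∣ᵥ ≡ n′ → ∣ a ∣ᵥ ≡ m
        ∣a∣≡m ∣b∣≡n′ = ℕₚ.+-cancelʳ-≡ n′ _ _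
          (trans (cong (∣ a ∣ᵥ ℕ.+_) (sym ∣b∣≡n′)) (∣a∣+∣b∣≡m+n′ a+b≡k))

      countWithSinks≡innerSum : + countWithSinks dec k S ≡ innerSum dec k m
      countWithSinks≡innerSum = begin
        + countWithSinks dec k S
          ≡⟨ cong +_ (countWithSinks≡∑-splits dec k S) ⟩
        + ℕΣ.∑ (splits k) (splitCount dec k S)
          ≡⟨ pos-∑ (splits k) _ ⟩
        ∑[ p ← splits k ] (+ splitCount dec k S p)
          ≡⟨ ∑-congᴬ (splits-sound k) (λ (a , b) → pos-splitCount a b) ⟩
        ∑[ p ← splits k ] (𝟙 (∣ proj₁ p ∣ᵥ ℕ.≟ m) ℤ.* innerTerm p)
          ≡⟨ ∑-filter (λ p → ∣ proj₁ p ∣ᵥ ℕ.≟ m) (splits k) innerTerm ⟨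
        innerSum dec k m ∎
        where
        open ≡-Reasoning
        innerTerm : Vec ℕ (suc d) × Vec ℕ (suc d) → ℤ
        innerTerm (a , b) = attachments ∣ k ∣ᵥ m a b ℤ.* + aCount dec b

    aCount≡∑-ieWeight : ∀ {d} (dec : EssProfileDecider d) (k : Vec ℕ (suc d)) → 1 ≤ ∣ k ∣ᵥ →
      + aCount dec k ≡ ∑[ S ← allSubsets ∣ k ∣ᵥ ] (ieWeight ∣ S ∣ ℤ.* + countWithSinks dec k S)
    aCount≡∑-ieWeight dec k 1≤n = begin
      + aCount dec k
        ≡⟨ trans (cong +_ (length-filter≡∑ (dec k) (allGraphs n))) (pos-∑-𝟙 (dec k) (allGraphs n)) ⟩
      ∑[ G ← allGraphs n ] 𝟙 (dec k G)
        ≡⟨ ∑-cong (allGraphs n) (λ G → sym (ℤₚ.*-identityʳ _)) ⟩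
      ∑[ G ← allGraphs n ] (𝟙 (dec k G) ℤ.* 1ℤ)
        ≡⟨ ∑-cong (allGraphs n) (λ G → 𝟙-*-cong (dec k G) λ ((acyclic , _) , _) →
             sym (∑-⊆-ieWeight (sinks G) (sinks-nonempty G acyclic (Fin.fromℕ< 1≤n)))) ⟩
      ∑[ G ← allGraphs n ] (𝟙 (dec k G) ℤ.* ∑[ S ← allSubsets n ] (𝟙 (S ⊆? sinks G) ℤ.* ieWeight ∣ S ∣))
        ≡⟨ ∑-cong (allGraphs n) (λ G → *-distribˡ-∑ (allSubsets n) (𝟙 (dec k G)) _) ⟩
      ∑[ G ← allGraphs n ] ∑[ S ← allSubsets n ] (𝟙 (dec k G) ℤ.* (𝟙 (S ⊆? sinks G) ℤ.* ieWeight ∣ S ∣))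
        ≡⟨ ∑-comm (allGraphs n) (allSubsets n) _ ⟩
      ∑[ S ← allSubsets n ] ∑[ G ← allGraphs n ] (𝟙 (dec k G) ℤ.* (𝟙 (S ⊆? sinks G) ℤ.* ieWeight ∣ S ∣))
        ≡⟨ ∑-cong (allSubsets n) (λ S → ∑-cong (allGraphs n) (λ G →
             reorder (𝟙 (dec k G)) (𝟙 (S ⊆? sinks G)) (ieWeight ∣ S ∣))) ⟩
      ∑[ S ← allSubsets n ] ∑[ G ← allGraphs n ] (ieWeight ∣ S ∣ ℤ.* (𝟙 (S ⊆? sinks G) ℤ.* 𝟙 (dec k G)))
        ≡⟨ ∑-cong (allSubsets n) (λ S → *-distribˡ-∑ (allGraphs n) (ieWeight ∣ S ∣) _) ⟨
      ∑[ S ← allSubsets n ] (ieWeight ∣ S ∣ ℤ.* ∑[ G ← allGraphs n ] (𝟙 (S ⊆? sinks G) ℤ.* 𝟙 (dec k G)))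
        ≡⟨ ∑-cong (allSubsets n) (λ S → cong (ieWeight ∣ S ∣ ℤ.*_) (sym (pos-countWithSinks S))) ⟩
      ∑[ S ← allSubsets n ] (ieWeight ∣ S ∣ ℤ.* + countWithSinks dec k S) ∎
      where
      open ≡-Reasoning
      n : ℕ
      n = ∣ k ∣ᵥ
      reorder : ∀ e s w → e ℤ.* (s ℤ.* w) ≡ w ℤ.* (s ℤ.* e)
      reorder = solve-∀
      pos-countWithSinks : ∀ S →
        + countWithSinks dec k S ≡ ∑[ G ← allGraphs n ] (𝟙 (S ⊆? sinks G) ℤ.* 𝟙 (dec k G))
      pos-countWithSinks S = trans (pos-∑ (allGraphs n) _) (∑-cong (allGraphs n) λ G →
        trans (pos-𝟙* (S ⊆? sinks G) (ℕΣ.𝟙 (dec k G))) (cong (𝟙 (S ⊆? sinks G) ℤ.*_) (pos-𝟙 (dec k G))))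

open Recursion

open import Data.Integer using (+_)

mainTheorem6 : (d : ℕ)
    → (dec : (k : Vec ℕ (suc d)) (G : Graph ∣ k ∣ᵥ) → Dec (EssProfile k G))
    → (k : Vec ℕ (suc d)) → 1 ≤ ∣ k ∣ᵥ
    → + aCount dec k ≡ rhs dec k
mainTheorem6 d dec k 1≤n = begin
  + aCount dec k
    ≡⟨ aCount≡∑-ieWeight dec k 1≤n ⟩
  ∑[ S ← allSubsets n ] (ieWeight ∣ S ∣ ℤ.* + countWithSinks dec k S)
    ≡⟨ ∑-cong (allSubsets n) (λ S → cong (ieWeight ∣ S ∣ ℤ.*_) (countWithSinks≡innerSum dec k S)) ⟩
  ∑[ S ← allSubsets n ] (ieWeight ∣ S ∣ ℤ.* innerSum dec k ∣ S ∣)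
    ≡⟨ ∑-ieWeight-by-size n (innerSum dec k) ⟩
  rhs dec k ∎
  where
  open ≡-Reasoning
  open ℤΣ using (∑; ∑-cong)
  n : ℕ
  n = ∣ k ∣ᵥ
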